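{- Let $\Lambda$ be an Eulerian lattice of rank $n$ and $\nu\in\Lambda$ with $\hat0<\nu<\hat1$. Let $\Lambda_\nu=\{\sigma\in\Lambda:\sigma\vee\nu<\hat1\}$ and $\Lambda'_\nu=\Lambda_\nu\cup\{*\}$, where $*$ is a new element of rank $n$ with $\sigma<*$ exactly for those $\sigma\in\Lambda_\nu$ with $\nu\not\le\sigma$. Then \[\Psi_{\Lambda'_\nu}=\sum_{\nu\le\pi<\hat1}\Psi_{[\hat0,\pi)}\cdot\alpha_{\rho(\pi,\hat1)}.\]
   Context: Conventions: all posets are finite and graded, have a minimum $\hat0$ of rank $0$, and need not have a maximum. $\rho$ is rank, $\rho(x,y)=\rho(y)-\rho(x)$. For $\Lambda$ of rank $n$, $\hat1$ is a formally adjoined maximum of rank $n+1$; $\Lambda$ is a lattice if $\Lambda\cup\{\hat1\}$ is a lattice, and $\vee$ is the join in $\Lambda\cup\{\hat1\}$. $\Lambda$ is Eulerian if for all $\tau<\pi$ in $\Lambda\cup\{\hat1\}$, $\sum_{\tau\le\sigma\le\pi}(-1)^{\rho(\tau,\sigma)}=0$. $\mathbf{a}\mathbf{b}$-index: for a chain $x=\{\hat0=\sigma_0<\cdots<\sigma_k\}$ in a poset $P$ with top $\hat1$, $\mathrm{wt}(x)=(\mathbf a-\mathbf b)^{\rho(\sigma_0,\sigma_1)-1}\mathbf b\cdots\mathbf b(\mathbf a-\mathbf b)^{\rho(\sigma_k,\hat1)-1}$ (noncommuting variables) and $\Psi_P=\sum_x\mathrm{wt}(x)$. For $\Lambda'_\nu$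 the top has rank $n+1$ (and $\rho(*)=n$); for $[\hat0,\pi)=\{\sigma:\sigma<\pi\}$ the top is $\pi$. Here $\mathbf c=\mathbf a+\mathbf b$, $\mathbf d=\mathbf a\mathbf b+\mathbf b\mathbf a$, and $\alpha_0=-1$, $\alpha_{2k}=-\tfrac12[(\mathbf c^2-2\mathbf d)^k+\mathbf c(\mathbf c^2-2\mathbf d)^{k-1}\mathbf c]$ for $k\ge1$, $\alpha_{2k+1}=\tfrac12[(\mathbf c^2-2\mathbf d)^k\mathbf c+\mathbf c(\mathbf c^2-2\mathbf d)^k]$ for $k\ge0$. -}

module Defs where

open import Data.Bool using (Bool; true; false; T; not; _∧_; if_then_else_)
open import Data.Nat using (ℕ; zero; suc; _∸_) renaming (_+_ to _+ℕ_)
open import Data.Fin using (Fin)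
import Data.Fin as F
open import Data.Fin.Properties using () renaming (_≟_ to _≟F_)
open import Data.List using (List; []; _∷_; _++_; map; filter; concatMap; foldr; length; allFin)
open import Data.Product using (_×_; _,_; Σ; ∃)
open import Data.Sum using (_⊎_; inj₁; inj₂)
open import Data.Integer as ℤ using (ℤ)
open import Data.Rational as Q using (ℚ)
open import Relation.Binary.PropositionalEquality using (_≡_; _≢_)
open import Relation.Nullary using (¬_)
open import Relation.Nullary.Decidable using (⌊_⌋)

data Letter : Set where
  𝐚 𝐛 : Letter

Word : Set
Word = List Letter

_==L_ : Letter → Letter → Bool
𝐚 ==L 𝐚 = true
𝐛 ==L 𝐛 = true
_ ==L _ = false

_==W_ : Word → Word → Bool
[] ==W [] = true
(x ∷ u) ==W (y ∷ v) = (x ==L y) ∧ (u ==W v)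
_ ==W _ = false

-- a polynomial is a formal finite sum of monomials  c · w
Poly : Set
Poly = List (ℚ × Word)

coeff : Poly → Word → ℚ
coeff [] w = Q.0ℚ
coeff ((c , u) ∷ p) w = (if u ==W w then c else Q.0ℚ) Q.+ coeff p w

_≈ᴾ_ : Poly → Poly → Set
p ≈ᴾ q = ∀ w → coeff p w ≡ coeff q w

infix 4 _≈ᴾ_
infixl 6 _+ᴾ_ _-ᴾ_
infixl 7 _*ᴾ_ _·ᴾ_

0ᴾ : Poly
0ᴾ = []

1ᴾ : Poly
1ᴾ = (Q.1ℚ , []) ∷ []

_+ᴾ_ : Poly → Poly → Poly
p +ᴾ q = p ++ q

_·ᴾ_ : ℚ → Poly → Poly
r ·ᴾ p = map (λ { (c , w) → (r Q.* c , w) }) p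

_-ᴾ_ : Poly → Poly → Poly
p -ᴾ q = p +ᴾ (Q.- Q.1ℚ) ·ᴾ q

_*ᴾ_ : Poly → Poly → Poly
p *ᴾ q = concatMap (λ { (c , u) → map (λ { (d , v) → (c Q.* d , u ++ v) }) q }) p

_^ᴾ_ : Poly → ℕ → Poly
p ^ᴾ zero = 1ᴾ
p ^ᴾ suc k = p *ᴾ (p ^ᴾ k)

aᴾ bᴾ cᴾ dᴾ : Poly
aᴾ = (Q.1ℚ , 𝐚 ∷ []) ∷ []
bᴾ = (Q.1ℚ , 𝐛 ∷ []) ∷ []
cᴾ = aᴾ +ᴾ bᴾ
dᴾ = aᴾ *ᴾ bᴾ +ᴾ bᴾ *ᴾ aᴾ

eᴾ : Poly
eᴾ = cᴾ *ᴾ cᴾ -ᴾ (Q.1ℚ Q.+ Q.1ℚ) ·ᴾ dᴾ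

-- parity split: inj₁ k means 2k, inj₂ k means 2k+1
split : ℕ → ℕ ⊎ ℕ
split zero = inj₁ zero
split (suc m) with split m
... | inj₁ k = inj₂ k
... | inj₂ k = inj₁ (suc k)

α : ℕ → Poly
α m with split m
... | inj₁ zero = (Q.- Q.1ℚ) ·ᴾ 1ᴾ
... | inj₁ (suc k) = (Q.- Q.½) ·ᴾ ((eᴾ ^ᴾ suc k) +ᴾ cᴾ *ᴾ (eᴾ ^ᴾ k) *ᴾ cᴾ)
... | inj₂ k = Q.½ ·ᴾ ((eᴾ ^ᴾ k) *ᴾ cᴾ +ᴾ cᴾ *ᴾ (eᴾ ^ᴾ k))

sumᴾ : List Poly → Poly
sumᴾ = foldr _+ᴾ_ 0ᴾ

-- ab-index of a finite graded poset with a minimum, relative to a top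
-- element of a given rank.
--   elems : the elements of the poset (listed without repetition)
--   lt    : the strict order
--   rk    : the rank
--   b0    : the minimum \hat0
--   top   : rank of the top \hat1
-- A chain \hat0 = σ₀ < σ₁ < ... < σₖ is represented by the list σ₁ … σₖ.

module ABIndex {E : Set} (elems : List E) (lt : E → E → Bool) (rk : E → ℕ) where

  -- strictly increasing lists above x, of length at most the fuel
  chainsAbove : ℕ → E → List (List E)
  chainsAbove zero x = [] ∷ []
  chainsAbove (suc f) x =
    [] ∷ concatMap (λ y → map (y ∷_) (chainsAbove f y)) (filter (λ y → T? (lt x y)) elems)
    where
      T? : (b : Bool) → Relation.Nullary.Dec (T b)
      T? true = Relation.Nullary.yes _
      T? false = Relation.Nullary.no (λ ())

  gap : ℕ → ℕ → Poly
  gap r s = (aᴾ -ᴾ bᴾ) ^ᴾ ((s ∸ r) ∸ 1)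

  wtFrom : ℕ → E → List E → Poly
  wtFrom top x [] = gap (rk x) top
  wtFrom top x (y ∷ ys) = gap (rk x) (rk y) *ᴾ bᴾ *ᴾ wtFrom top y ys

  Ψ : E → ℕ → Poly
  Ψ b0 top = sumᴾ (map (wtFrom top b0) (chainsAbove (length elems) b0))

data Hat (N : ℕ) : Set where
  el  : Fin N → Hat N
  one : Hat N

module HatOps {N : ℕ} (n : ℕ) (le : Fin N → Fin N → Bool) (rk : Fin N → ℕ) where

  lt : Fin N → Fin N → Bool
  lt x y = le x y ∧ not ⌊ x ≟F y ⌋

  leH : Hat N → Hat N → Bool
  leH _ one = true
  leH one (el _) = false
  leH (el x) (el y) = le x y

  ltH : Hat N → Hat N → Bool
  ltH (el x) one = true
  ltH one one = false
  ltH one (el _) = false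
  ltH (el x) (el y) = lt x y

  rkH : Hat N → ℕ
  rkH one = suc n
  rkH (el x) = rk x

  elemsH : List (Hat N)
  elemsH = one ∷ map el (allFin N)

  Covers : Hat N → Hat N → Set
  Covers x y = T (ltH x y) × (∀ z → ¬ (T (ltH x z) × T (ltH z y)))

record GradedPoset (n : ℕ) : Set₁ where
  field
    N    : ℕ
    le   : Fin N → Fin N → Bool
    rk   : Fin N → ℕ
    bot  : Fin N
    refl≤  : ∀ x → T (le x x)
    antisym : ∀ x y → T (le x y) → T (le y x) → x ≡ y
    trans≤ : ∀ x y z → T (le x y) → T (le y z) → T (le x z)
    bot≤ : ∀ x → T (le bot x)
    -- graded of rank n: ρ(\hat0) = 0 and ρ increases by one along covers
    -- in Λ ∪ {\hat1} (so every maximal element of Λ has rank n)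
    rk-bot : rk bot ≡ 0
    rk-cover : ∀ x y → HatOps.Covers n le rk x y →
                 HatOps.rkH n le rk y ≡ suc (HatOps.rkH n le rk x)

  open HatOps n le rk public

-- Λ ∪ {\hat1} is a lattice; the join is part of the data (it is unique)
record IsLattice {n : ℕ} (Λ : GradedPoset n) : Set where
  open GradedPoset Λ
  field
    join : Hat N → Hat N → Hat N
    join-ub₁ : ∀ x y → T (leH x (join x y))
    join-ub₂ : ∀ x y → T (leH y (join x y))
    join-least : ∀ x y z → T (leH x z) → T (leH y z) → T (leH (join x y) z)
    meet-exists : ∀ x y → ∃ λ m → T (leH m x) × T (leH m y)
                    × (∀ z → T (leH z x) → T (leH z y) → T (leH z m))

sign : ℕ → ℤ
sign zero = ℤ.1ℤ
sign (suc k) = ℤ.- sign k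

IsEulerian : {n : ℕ} → GradedPoset n → Set
IsEulerian Λ = ∀ τ π → T (ltH τ π) →
  foldr ℤ._+_ ℤ.0ℤ
    (map (λ σ → sign (rkH σ ∸ rkH τ)) (filter (λ σ → T? (leH τ σ ∧ leH σ π)) elemsH))
    ≡ ℤ.0ℤ
  where
    open GradedPoset Λ
    T? : (b : Bool) → Relation.Nullary.Dec (T b)
    T? true = Relation.Nullary.yes _
    T? false = Relation.Nullary.no (λ ())

data Prime (N : ℕ) : Set where
  old  : Fin N → Prime N
  star : Prime N

module Construction {n : ℕ} (Λ : GradedPoset n) (L : IsLattice Λ) (ν : Fin (GradedPoset.N Λ)) where
  open GradedPoset Λ
  open IsLattice L

  isOne : Hat N → Bool
  isOne one = true
  isOne (el _) = false

  inΛν : Fin N → Bool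
  inΛν σ = not (isOne (join (el σ) (el ν)))

  private
    T? : (b : Bool) → Relation.Nullary.Dec (T b)
    T? true = Relation.Nullary.yes _
    T? false = Relation.Nullary.no (λ ())

  elemsΛ'ν : List (Prime N)
  elemsΛ'ν = star ∷ map old (filter (λ σ → T? (inΛν σ)) (allFin N))

  ltΛ'ν : Prime N → Prime N → Bool
  ltΛ'ν (old x) (old y) = lt x y
  ltΛ'ν (old x) star = not (le ν x)
  ltΛ'ν star _ = false

  rkΛ'ν : Prime N → ℕ
  rkΛ'ν (old x) = rk x
  rkΛ'ν star = n

  ΨΛ'ν : Poly
  ΨΛ'ν = ABIndex.Ψ elemsΛ'ν ltΛ'ν rkΛ'ν (old bot) (suc n)

  Ψbelow : Fin N → Poly
  Ψbelow π = ABIndex.Ψ (filter (λ σ → T? (lt σ π)) (allFin N)) lt rk bot (rk π)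

  RHS : Poly
  RHS = sumᴾ (map (λ π → Ψbelow π *ᴾ α (suc n ∸ rk π))
                  (filter (λ π → T? (le ν π)) (allFin N)))

Fin' : {n : ℕ} → GradedPoset n → Set
Fin' Λ = Fin (GradedPoset.N Λ)

-- A chain of Λ'_ν ends in Λ_ν or passes through *, which lies above exactly the σ ∈ Λ_ν
-- with ν ≰ σ; so Ψ_{Λ'_ν} is a sum over chains of Λ_ν with end weight
-- (a−b)^{n−ρσ} + [ν ≰ σ] (a−b)^{n−ρσ−1} b. As Λ is an Eulerian lattice,
-- Σ_{π ≥ σ ∨ ν, π < 1̂} (−1)^{n−ρπ} = [σ ∨ ν < 1̂] = [σ ∈ Λ_ν], which writes the indicator of Λ_ν as a
-- signed sum over the π ≥ ν, and [ν ≤ σ] is the diagonal term π = σ. Exchanging the sums, the chains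
-- with end weights supported on [0̂, π] contribute Ψ_{[0̂,π)} times a polynomial in a−b and b, and
-- since c = (a−b) + 2b and c² − 2d = (a−b)², that polynomial is α_{ρ(π,1̂)}.

module Submission where

open import Defs
open import Data.Bool using (Bool; true; false; if_then_else_; _∧_; not; T)
open import Data.Bool.Properties using (∧-zeroʳ; ∧-identityʳ; T-≡)
open import Data.Empty using (⊥-elim)
open import Data.Fin using (Fin; zero; suc)
open import Data.Fin.Properties using (_≟_)
open import Data.Integer as ℤ using (ℤ)
open import Data.List using (List; []; _∷_; _++_; map; concatMap; foldr; filter; allFin; length)
open import Data.List.Membership.Propositional using (_∈_)
open import Data.List.Membership.Propositional.Properties using (∈-allFin; ∈-map⁺)
open import Data.List.Properties
  using (length-tabulate; length-map; map-++; ++-assoc; map-cong; map-∘; concatMap-++; ++-identityʳ; map-tabulate)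
open import Data.List.Relation.Unary.Any using (here; there)
open import Data.Nat using (ℕ; zero; suc; _∸_; _≤_; _<_; z≤n; s≤s) renaming (_+_ to _+ℕ_)
open import Data.Nat.Properties
  using (+-suc; +-∸-assoc; m∸n+n≡m; m+n∸n≡m; m+[n∸m]≡n; m≤n⇒m≤1+n; n≤0⇒n≡0; ≤-pred; ≤-trans; <-trans; ≤-refl; <⇒≤; n<1+n)
  renaming (+-comm to +ℕ-comm; _≟_ to _≟ℕ_)
open import Data.Product using (_×_; _,_; ∃; proj₁; proj₂)
open import Data.Rational using (ℚ; 0ℚ; 1ℚ; ½; _+_; _*_; -_)
import Data.Rational.Properties as ℚP
open import Data.Rational.Solver using (module +-*-Solver)
open import Data.Sum using (inj₁)
open import Data.Unit using (tt)
open import Function using (_⟨_⟩_)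
open import Function.Bundles using (Equivalence)
open import Relation.Binary.Bundles using (Setoid)
open import Relation.Binary.PropositionalEquality
import Relation.Binary.Reasoning.Setoid as SetoidReasoning
open import Relation.Nullary using (Dec; yes; no; does; ¬_)
open +-*-Solver

Σℚ : ∀ {A : Set} → List A → (A → ℚ) → ℚ
Σℚ [] f = 0ℚ
Σℚ (x ∷ l) f = f x + Σℚ l f

module _ {A : Set} where

  Σℚ-cong : ∀ (l : List A) {f g : A → ℚ} → (∀ x → f x ≡ g x) → Σℚ l f ≡ Σℚ l g
  Σℚ-cong [] e = refl
  Σℚ-cong (x ∷ l) e = cong₂ _+_ (e x) (Σℚ-cong l e)

  Σℚ-+ : ∀ (l : List A) (f g : A → ℚ) → Σℚ l (λ x → f x + g x) ≡ Σℚ l f + Σℚ l g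
  Σℚ-+ [] f g = refl
  Σℚ-+ (x ∷ l) f g = trans (cong (f x + g x +_) (Σℚ-+ l f g))
    (solve 4 (λ a b c d → (a :+ b) :+ (c :+ d) := (a :+ c) :+ (b :+ d)) refl (f x) (g x) (Σℚ l f) (Σℚ l g))

  Σℚ-*ˡ : ∀ (l : List A) (c : ℚ) (f : A → ℚ) → Σℚ l (λ x → c * f x) ≡ c * Σℚ l f
  Σℚ-*ˡ [] c f = sym (ℚP.*-zeroʳ c)
  Σℚ-*ˡ (x ∷ l) c f = trans (cong (c * f x +_) (Σℚ-*ˡ l c f)) (sym (ℚP.*-distribˡ-+ c (f x) (Σℚ l f)))

  Σℚ-*ʳ : ∀ (l : List A) (c : ℚ) (f : A → ℚ) → Σℚ l (λ x → f x * c) ≡ Σℚ l f * c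
  Σℚ-*ʳ [] c f = sym (ℚP.*-zeroˡ c)
  Σℚ-*ʳ (x ∷ l) c f = trans (cong (f x * c +_) (Σℚ-*ʳ l c f)) (sym (ℚP.*-distribʳ-+ c (f x) (Σℚ l f)))

  Σℚ-zero : ∀ (l : List A) (f : A → ℚ) → (∀ x → f x ≡ 0ℚ) → Σℚ l f ≡ 0ℚ
  Σℚ-zero [] f e = refl
  Σℚ-zero (x ∷ l) f e = cong₂ _+_ (e x) (Σℚ-zero l f e)

Σℚ-map : ∀ {A B : Set} (h : A → B) (l : List A) (f : B → ℚ) → Σℚ (map h l) f ≡ Σℚ l (λ x → f (h x))
Σℚ-map h [] f = refl
Σℚ-map h (x ∷ l) f = cong (f (h x) +_) (Σℚ-map h l f)

[_]ℚ : Bool → ℚ → ℚ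
[ b ]ℚ c = if b then c else 0ℚ

[]ℚ-*ˡ : ∀ b c d → c * [ b ]ℚ d ≡ [ b ]ℚ (c * d)
[]ℚ-*ˡ true c d = refl
[]ℚ-*ˡ false c d = ℚP.*-zeroʳ c

coeff-+ᴾ : ∀ p q w → coeff (p +ᴾ q) w ≡ coeff p w + coeff q w
coeff-+ᴾ [] q w = sym (ℚP.+-identityˡ _)
coeff-+ᴾ ((c , u) ∷ p) q w =
  trans (cong ([ u ==W w ]ℚ c +_) (coeff-+ᴾ p q w)) (sym (ℚP.+-assoc ([ u ==W w ]ℚ c) (coeff p w) (coeff q w)))

coeff-·ᴾ : ∀ r p w → coeff (r ·ᴾ p) w ≡ r * coeff p w
coeff-·ᴾ r [] w = sym (ℚP.*-zeroʳ r)
coeff-·ᴾ r ((c , u) ∷ p) w =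
  trans (cong₂ _+_ (sym ([]ℚ-*ˡ (u ==W w) r c)) (coeff-·ᴾ r p w)) (sym (ℚP.*-distribˡ-+ r _ _))

coeff-diffᴾ : ∀ p q w → coeff (p -ᴾ q) w ≡ coeff p w + (- 1ℚ) * coeff q w
coeff-diffᴾ p q w = trans (coeff-+ᴾ p _ w) (cong (coeff p w +_) (coeff-·ᴾ (- 1ℚ) q w))

splits : Word → List (Word × Word)
splits [] = ([] , []) ∷ []
splits (x ∷ w) = ([] , x ∷ w) ∷ map (λ { (u , v) → (x ∷ u , v) }) (splits w)

monomial*ᴾ : ℚ → Word → Poly → Poly
monomial*ᴾ c u q = map (λ { (d , v) → (c * d , u ++ v) }) q

Σℚ-splits-indicator : ∀ u v w c d →
  Σℚ (splits w) (λ { (u' , v') → [ u ==W u' ]ℚ c * [ v ==W v' ]ℚ d }) ≡ [ (u ++ v) ==W w ]ℚ (c * d)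
Σℚ-splits-indicator [] [] [] c d = ℚP.+-identityʳ (c * d)
Σℚ-splits-indicator [] (x ∷ v) [] c d = trans (ℚP.+-identityʳ (c * 0ℚ)) (ℚP.*-zeroʳ c)
Σℚ-splits-indicator (y ∷ u) v [] c d =
  trans (ℚP.+-identityʳ (0ℚ * [ v ==W [] ]ℚ d)) (ℚP.*-zeroˡ ([ v ==W [] ]ℚ d))
Σℚ-splits-indicator [] v (x ∷ w) c d =
  trans (cong₂ _+_ ([]ℚ-*ˡ (v ==W (x ∷ w)) c d)
                   (trans (Σℚ-map (λ { (u , v) → (x ∷ u , v) }) (splits w) term)
                          (Σℚ-zero (splits w) _ (λ { (u' , v') → ℚP.*-zeroˡ ([ v ==W v' ]ℚ d) }))))
        (ℚP.+-identityʳ ([ v ==W (x ∷ w) ]ℚ (c * d)))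
  where
  term : Word × Word → ℚ
  term (u' , v') = [ [] ==W u' ]ℚ c * [ v ==W v' ]ℚ d
Σℚ-splits-indicator (y ∷ u) v (x ∷ w) c d =
  trans (cong₂ _+_ (ℚP.*-zeroˡ ([ v ==W (x ∷ w) ]ℚ d)) (Σℚ-map (λ { (u , v) → (x ∷ u , v) }) (splits w) term))
        (trans (ℚP.+-identityˡ _) (tail (y ==L x)))
  where
  term : Word × Word → ℚ
  term (u' , v') = [ (y ∷ u) ==W u' ]ℚ c * [ v ==W v' ]ℚ d
  tail : ∀ b → Σℚ (splits w) (λ { (u' , v') → [ b ∧ (u ==W u') ]ℚ c * [ v ==W v' ]ℚ d })
             ≡ [ b ∧ ((u ++ v) ==W w) ]ℚ (c * d)
  tail true = Σℚ-splits-indicator u v w c d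
  tail false = Σℚ-zero (splits w) _ (λ { (u' , v') → ℚP.*-zeroˡ ([ v ==W v' ]ℚ d) })

coeff-monomial*ᴾ : ∀ c u q w →
  coeff (monomial*ᴾ c u q) w ≡ Σℚ (splits w) (λ { (u' , v') → [ u ==W u' ]ℚ c * coeff q v' })
coeff-monomial*ᴾ c u [] w = sym (Σℚ-zero (splits w) _ (λ { (u' , v') → ℚP.*-zeroʳ ([ u ==W u' ]ℚ c) }))
coeff-monomial*ᴾ c u ((d , v) ∷ q) w =
  trans (cong₂ _+_ (sym (Σℚ-splits-indicator u v w c d)) (coeff-monomial*ᴾ c u q w))
        (trans (sym (Σℚ-+ (splits w) _ _))
               (Σℚ-cong (splits w) (λ { (u' , v') → sym (ℚP.*-distribˡ-+ ([ u ==W u' ]ℚ c) _ _) })))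

coeff-*ᴾ : ∀ p q w → coeff (p *ᴾ q) w ≡ Σℚ (splits w) (λ { (u , v) → coeff p u * coeff q v })
coeff-*ᴾ [] q w = sym (Σℚ-zero (splits w) _ (λ { (u' , v') → ℚP.*-zeroˡ (coeff q v') }))
coeff-*ᴾ ((c , u) ∷ p) q w =
  trans (coeff-+ᴾ (monomial*ᴾ c u q) (p *ᴾ q) w)
        (trans (cong₂ _+_ (coeff-monomial*ᴾ c u q w) (coeff-*ᴾ p q w))
               (trans (sym (Σℚ-+ (splits w) _ _))
                      (Σℚ-cong (splits w) (λ { (u' , v') →
                         sym (ℚP.*-distribʳ-+ (coeff q v') ([ u ==W u' ]ℚ c) (coeff p u')) }))))

-- A record, so that both sides are recoverable from a proof.
infix 4 _≋_
record _≋_ (p q : Poly) : Set where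
  constructor ≈⇒≋
  field ≋⇒≈ : p ≈ᴾ q
open _≋_ public

≋-refl : ∀ {p} → p ≋ p
≋-refl = ≈⇒≋ (λ w → refl)

≋-sym : ∀ {p q} → p ≋ q → q ≋ p
≋-sym e = ≈⇒≋ (λ w → sym (≋⇒≈ e w))

≋-trans : ∀ {p q r} → p ≋ q → q ≋ r → p ≋ r
≋-trans e f = ≈⇒≋ (λ w → trans (≋⇒≈ e w) (≋⇒≈ f w))

≡⇒≋ : ∀ {p q} → p ≡ q → p ≋ q
≡⇒≋ refl = ≋-refl

≋-setoid : Setoid _ _
≋-setoid = record { Carrier = Poly ; _≈_ = _≋_ ;
  isEquivalence = record { refl = ≋-refl ; sym = ≋-sym ; trans = ≋-trans } }

module ≋-Reasoning = SetoidReasoning ≋-setoid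

+ᴾ-cong : ∀ {p p' q q'} → p ≋ p' → q ≋ q' → p +ᴾ q ≋ p' +ᴾ q'
+ᴾ-cong {p} {p'} {q} {q'} e f = ≈⇒≋ (λ w →
  trans (coeff-+ᴾ p q w) (trans (cong₂ _+_ (≋⇒≈ e w) (≋⇒≈ f w)) (sym (coeff-+ᴾ p' q' w))))

+ᴾ-congˡ : ∀ {p p'} q → p ≋ p' → p +ᴾ q ≋ p' +ᴾ q
+ᴾ-congˡ q e = +ᴾ-cong e ≋-refl

+ᴾ-congʳ : ∀ p {q q'} → q ≋ q' → p +ᴾ q ≋ p +ᴾ q'
+ᴾ-congʳ p e = +ᴾ-cong ≋-refl e

+ᴾ-assoc : ∀ p q r → (p +ᴾ q) +ᴾ r ≋ p +ᴾ (q +ᴾ r)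
+ᴾ-assoc p q r = ≡⇒≋ (++-assoc p q r)

+ᴾ-identityʳ : ∀ p → p +ᴾ 0ᴾ ≋ p
+ᴾ-identityʳ p = ≡⇒≋ (++-identityʳ p)

+ᴾ-medial : ∀ p q r s → (p +ᴾ q) +ᴾ (r +ᴾ s) ≋ (p +ᴾ r) +ᴾ (q +ᴾ s)
+ᴾ-medial p q r s = ≈⇒≋ (λ w → begin
  coeff ((p +ᴾ q) +ᴾ (r +ᴾ s)) w
    ≡⟨ trans (coeff-+ᴾ (p +ᴾ q) (r +ᴾ s) w) (cong₂ _+_ (coeff-+ᴾ p q w) (coeff-+ᴾ r s w)) ⟩
  (coeff p w + coeff q w) + (coeff r w + coeff s w)
    ≡⟨ solve 4 (λ x y z t → (x :+ y) :+ (z :+ t) := (x :+ z) :+ (y :+ t)) refl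
         (coeff p w) (coeff q w) (coeff r w) (coeff s w) ⟩
  (coeff p w + coeff r w) + (coeff q w + coeff s w)
    ≡⟨ sym (trans (coeff-+ᴾ (p +ᴾ r) (q +ᴾ s) w) (cong₂ _+_ (coeff-+ᴾ p r w) (coeff-+ᴾ q s w))) ⟩
  coeff ((p +ᴾ r) +ᴾ (q +ᴾ s)) w ∎)
  where open ≡-Reasoning

·ᴾ-cong : ∀ r {p q} → p ≋ q → r ·ᴾ p ≋ r ·ᴾ q
·ᴾ-cong r {p} {q} e = ≈⇒≋ (λ w →
  trans (coeff-·ᴾ r p w) (trans (cong (r *_) (≋⇒≈ e w)) (sym (coeff-·ᴾ r q w))))

·ᴾ-distrib-+ᴾ : ∀ r p q → r ·ᴾ (p +ᴾ q) ≋ r ·ᴾ p +ᴾ r ·ᴾ q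
·ᴾ-distrib-+ᴾ r p q = ≡⇒≋ (map-++ _ p q)

-ᴾ-cong : ∀ {p p' q q'} → p ≋ p' → q ≋ q' → p -ᴾ q ≋ p' -ᴾ q'
-ᴾ-cong e f = +ᴾ-cong e (·ᴾ-cong (- 1ℚ) f)

*ᴾ-congˡ : ∀ {p p'} q → p ≋ p' → p *ᴾ q ≋ p' *ᴾ q
*ᴾ-congˡ {p} {p'} q e = ≈⇒≋ (λ w → trans (coeff-*ᴾ p q w)
  (trans (Σℚ-cong (splits w) (λ { (u , v) → cong (_* coeff q v) (≋⇒≈ e u) })) (sym (coeff-*ᴾ p' q w))))

*ᴾ-congʳ : ∀ p {q q'} → q ≋ q' → p *ᴾ q ≋ p *ᴾ q'
*ᴾ-congʳ p {q} {q'} e = ≈⇒≋ (λ w → trans (coeff-*ᴾ p q w)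
  (trans (Σℚ-cong (splits w) (λ { (u , v) → cong (coeff p u *_) (≋⇒≈ e v) })) (sym (coeff-*ᴾ p q' w))))

*ᴾ-cong : ∀ {p p' q q'} → p ≋ p' → q ≋ q' → p *ᴾ q ≋ p' *ᴾ q'
*ᴾ-cong {p' = p'} {q = q} e f = ≋-trans (*ᴾ-congˡ q e) (*ᴾ-congʳ p' f)

*ᴾ-distribʳ : ∀ p q r → (p +ᴾ q) *ᴾ r ≋ p *ᴾ r +ᴾ q *ᴾ r
*ᴾ-distribʳ p q r = ≡⇒≋ (concatMap-++ _ p q)

*ᴾ-distribˡ : ∀ p q r → p *ᴾ (q +ᴾ r) ≋ p *ᴾ q +ᴾ p *ᴾ r
*ᴾ-distribˡ p q r = ≈⇒≋ (λ w → begin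
  coeff (p *ᴾ (q +ᴾ r)) w
    ≡⟨ coeff-*ᴾ p (q +ᴾ r) w ⟩
  Σℚ (splits w) (λ { (u , v) → coeff p u * coeff (q +ᴾ r) v })
    ≡⟨ Σℚ-cong (splits w) (λ { (u , v) →
         trans (cong (coeff p u *_) (coeff-+ᴾ q r v)) (ℚP.*-distribˡ-+ (coeff p u) (coeff q v) (coeff r v)) }) ⟩
  Σℚ (splits w) (λ { (u , v) → coeff p u * coeff q v + coeff p u * coeff r v })
    ≡⟨ Σℚ-+ (splits w) _ _ ⟩
  Σℚ (splits w) (λ { (u , v) → coeff p u * coeff q v }) + Σℚ (splits w) (λ { (u , v) → coeff p u * coeff r v })
    ≡⟨ cong₂ _+_ (sym (coeff-*ᴾ p q w)) (sym (coeff-*ᴾ p r w)) ⟩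
  coeff (p *ᴾ q) w + coeff (p *ᴾ r) w
    ≡⟨ sym (coeff-+ᴾ (p *ᴾ q) (p *ᴾ r) w) ⟩
  coeff (p *ᴾ q +ᴾ p *ᴾ r) w ∎)
  where open ≡-Reasoning

monomial*ᴾ-*ᴾ : ∀ c u q r → monomial*ᴾ c u q *ᴾ r ≡ monomial*ᴾ c u (q *ᴾ r)
monomial*ᴾ-*ᴾ c u [] r = refl
monomial*ᴾ-*ᴾ c u ((d , v) ∷ q) r =
  trans (cong (monomial*ᴾ (c * d) (u ++ v) r ++_) (monomial*ᴾ-*ᴾ c u q r))
        (trans (cong (_++ monomial*ᴾ c u (q *ᴾ r))
                     (trans (map-cong (λ { (e , w) → cong₂ _,_ (ℚP.*-assoc c d e) (++-assoc u v w) }) r) (map-∘ r)))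
               (sym (map-++ _ (monomial*ᴾ d v r) (q *ᴾ r))))

*ᴾ-assoc : ∀ p q r → (p *ᴾ q) *ᴾ r ≋ p *ᴾ (q *ᴾ r)
*ᴾ-assoc p q r = ≡⇒≋ (assoc p)
  where
  assoc : ∀ p → (p *ᴾ q) *ᴾ r ≡ p *ᴾ (q *ᴾ r)
  assoc [] = refl
  assoc ((c , u) ∷ p) =
    trans (concatMap-++ _ (monomial*ᴾ c u q) (p *ᴾ q)) (cong₂ _++_ (monomial*ᴾ-*ᴾ c u q r) (assoc p))

*ᴾ-identityˡ : ∀ p → 1ᴾ *ᴾ p ≋ p
*ᴾ-identityˡ p = ≡⇒≋ (trans (++-identityʳ _) (identity p))
  where
  identity : ∀ p → monomial*ᴾ 1ℚ [] p ≡ p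
  identity [] = refl
  identity ((c , u) ∷ p) = cong₂ _∷_ (cong (_, u) (ℚP.*-identityˡ c)) (identity p)

*ᴾ-identityʳ : ∀ p → p *ᴾ 1ᴾ ≋ p
*ᴾ-identityʳ p = ≡⇒≋ (identity p)
  where
  identity : ∀ p → p *ᴾ 1ᴾ ≡ p
  identity [] = refl
  identity ((c , u) ∷ p) = cong₂ _∷_ (cong₂ _,_ (ℚP.*-identityʳ c) (++-identityʳ u)) (identity p)

*ᴾ-zeroʳ : ∀ p → p *ᴾ 0ᴾ ≋ 0ᴾ
*ᴾ-zeroʳ p = ≡⇒≋ (annihilates p)
  where
  annihilates : ∀ p → p *ᴾ 0ᴾ ≡ 0ᴾ
  annihilates [] = refl
  annihilates (_ ∷ p) = annihilates p

*ᴾ-·ᴾʳ : ∀ r p q → p *ᴾ (r ·ᴾ q) ≋ r ·ᴾ (p *ᴾ q)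
*ᴾ-·ᴾʳ r p q = ≈⇒≋ (λ w → begin
  coeff (p *ᴾ (r ·ᴾ q)) w
    ≡⟨ coeff-*ᴾ p (r ·ᴾ q) w ⟩
  Σℚ (splits w) (λ { (u , v) → coeff p u * coeff (r ·ᴾ q) v })
    ≡⟨ Σℚ-cong (splits w) (λ { (u , v) → trans (cong (coeff p u *_) (coeff-·ᴾ r q v))
         (solve 3 (λ x y z → x :* (y :* z) := y :* (x :* z)) refl (coeff p u) r (coeff q v)) }) ⟩
  Σℚ (splits w) (λ { (u , v) → r * (coeff p u * coeff q v) })
    ≡⟨ Σℚ-*ˡ (splits w) r _ ⟩
  r * Σℚ (splits w) (λ { (u , v) → coeff p u * coeff q v })
    ≡⟨ cong (r *_) (sym (coeff-*ᴾ p q w)) ⟩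
  r * coeff (p *ᴾ q) w
    ≡⟨ sym (coeff-·ᴾ r (p *ᴾ q) w) ⟩
  coeff (r ·ᴾ (p *ᴾ q)) w ∎)
  where open ≡-Reasoning

^ᴾ-+ : ∀ p i j → p ^ᴾ (i +ℕ j) ≋ (p ^ᴾ i) *ᴾ (p ^ᴾ j)
^ᴾ-+ p zero j = ≋-sym (*ᴾ-identityˡ (p ^ᴾ j))
^ᴾ-+ p (suc i) j = ≋-trans (*ᴾ-congʳ p (^ᴾ-+ p i j)) (≋-sym (*ᴾ-assoc p (p ^ᴾ i) (p ^ᴾ j)))

^ᴾ-sucʳ : ∀ p k → p ^ᴾ suc k ≋ p ^ᴾ k *ᴾ p
^ᴾ-sucʳ p k = ≋-trans (≡⇒≋ (cong (p ^ᴾ_) (+ℕ-comm 1 k)))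
                      (≋-trans (^ᴾ-+ p k 1) (*ᴾ-congʳ (p ^ᴾ k) (*ᴾ-identityʳ p)))

-ᴾ-cancelʳ : ∀ p q → (p +ᴾ q) -ᴾ q ≋ p
-ᴾ-cancelʳ p q = ≈⇒≋ λ w → begin
  coeff ((p +ᴾ q) -ᴾ q) w
    ≡⟨ trans (coeff-diffᴾ (p +ᴾ q) q w) (cong (_+ (- 1ℚ) * coeff q w) (coeff-+ᴾ p q w)) ⟩
  (coeff p w + coeff q w) + (- 1ℚ) * coeff q w
    ≡⟨ solve 2 (λ x y → (x :+ y) :+ con (- 1ℚ) :* y := x) refl (coeff p w) (coeff q w) ⟩
  coeff p w ∎
  where open ≡-Reasoning

*ᴾ-distribˡ-combination : ∀ s p x y → s ·ᴾ (p *ᴾ x) -ᴾ p *ᴾ y ≋ p *ᴾ (s ·ᴾ x -ᴾ y)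
*ᴾ-distribˡ-combination s p x y = ≋-sym (≋-trans (*ᴾ-distribˡ p (s ·ᴾ x) ((- 1ℚ) ·ᴾ y))
                                                 (+ᴾ-cong (*ᴾ-·ᴾʳ s p x) (*ᴾ-·ᴾʳ (- 1ℚ) p y)))

*ᴾ-distribʳ-double : ∀ p q r → (p +ᴾ (q +ᴾ q)) *ᴾ r ≋ p *ᴾ r +ᴾ (q *ᴾ r +ᴾ q *ᴾ r)
*ᴾ-distribʳ-double p q r = ≋-trans (*ᴾ-distribʳ p (q +ᴾ q) r) (+ᴾ-congʳ (p *ᴾ r) (*ᴾ-distribʳ q q r))

∑ᴾ : ∀ {A : Set} → List A → (A → Poly) → Poly
∑ᴾ l F = sumᴾ (map F l)

coeff-∑ᴾ : ∀ {A : Set} (l : List A) F w → coeff (∑ᴾ l F) w ≡ Σℚ l (λ x → coeff (F x) w)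
coeff-∑ᴾ [] F w = refl
coeff-∑ᴾ (x ∷ l) F w = trans (coeff-+ᴾ (F x) (∑ᴾ l F) w) (cong (coeff (F x) w +_) (coeff-∑ᴾ l F w))

module _ {A : Set} where

  ∑ᴾ-cong : ∀ (l : List A) {F G : A → Poly} → (∀ x → F x ≋ G x) → ∑ᴾ l F ≋ ∑ᴾ l G
  ∑ᴾ-cong [] e = ≋-refl
  ∑ᴾ-cong (x ∷ l) e = +ᴾ-cong (e x) (∑ᴾ-cong l e)

  ∑ᴾ-zero : ∀ (l : List A) (F : A → Poly) → (∀ x → F x ≋ 0ᴾ) → ∑ᴾ l F ≋ 0ᴾ
  ∑ᴾ-zero [] F e = ≋-refl
  ∑ᴾ-zero (x ∷ l) F e = +ᴾ-cong (e x) (∑ᴾ-zero l F e)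

  ∑ᴾ-+ : ∀ (l : List A) (F G : A → Poly) → ∑ᴾ l (λ x → F x +ᴾ G x) ≋ ∑ᴾ l F +ᴾ ∑ᴾ l G
  ∑ᴾ-+ [] F G = ≋-refl
  ∑ᴾ-+ (x ∷ l) F G = ≋-trans (+ᴾ-congʳ (F x +ᴾ G x) (∑ᴾ-+ l F G)) (+ᴾ-medial (F x) (G x) (∑ᴾ l F) (∑ᴾ l G))

  ∑ᴾ-· : ∀ (l : List A) r (F : A → Poly) → ∑ᴾ l (λ x → r ·ᴾ F x) ≋ r ·ᴾ ∑ᴾ l F
  ∑ᴾ-· [] r F = ≋-refl
  ∑ᴾ-· (x ∷ l) r F = ≋-trans (+ᴾ-congʳ (r ·ᴾ F x) (∑ᴾ-· l r F)) (≋-sym (·ᴾ-distrib-+ᴾ r (F x) (∑ᴾ l F)))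

  ∑ᴾ-diff : ∀ (l : List A) (F G : A → Poly) → ∑ᴾ l (λ x → F x -ᴾ G x) ≋ ∑ᴾ l F -ᴾ ∑ᴾ l G
  ∑ᴾ-diff l F G = ≋-trans (∑ᴾ-+ l F (λ x → (- 1ℚ) ·ᴾ G x)) (+ᴾ-congʳ (∑ᴾ l F) (∑ᴾ-· l (- 1ℚ) G))

  ∑ᴾ-*ʳ : ∀ (l : List A) (F : A → Poly) r → ∑ᴾ l F *ᴾ r ≋ ∑ᴾ l (λ x → F x *ᴾ r)
  ∑ᴾ-*ʳ [] F r = ≋-refl
  ∑ᴾ-*ʳ (x ∷ l) F r = ≋-trans (*ᴾ-distribʳ (F x) (∑ᴾ l F) r) (+ᴾ-congʳ (F x *ᴾ r) (∑ᴾ-*ʳ l F r))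

  ∑ᴾ-*ˡ : ∀ (l : List A) (F : A → Poly) r → r *ᴾ ∑ᴾ l F ≋ ∑ᴾ l (λ x → r *ᴾ F x)
  ∑ᴾ-*ˡ [] F r = *ᴾ-zeroʳ r
  ∑ᴾ-*ˡ (x ∷ l) F r = ≋-trans (*ᴾ-distribˡ r (F x) (∑ᴾ l F)) (+ᴾ-congʳ (r *ᴾ F x) (∑ᴾ-*ˡ l F r))

  ∑ᴾ-++ : ∀ (l l' : List A) (F : A → Poly) → ∑ᴾ (l ++ l') F ≋ ∑ᴾ l F +ᴾ ∑ᴾ l' F
  ∑ᴾ-++ [] l' F = ≋-refl
  ∑ᴾ-++ (x ∷ l) l' F = ≋-trans (+ᴾ-congʳ (F x) (∑ᴾ-++ l l' F)) (≋-sym (+ᴾ-assoc (F x) (∑ᴾ l F) (∑ᴾ l' F)))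

∑ᴾ-map : ∀ {A B : Set} (h : A → B) (l : List A) (F : B → Poly) → ∑ᴾ (map h l) F ≋ ∑ᴾ l (λ x → F (h x))
∑ᴾ-map h [] F = ≋-refl
∑ᴾ-map h (x ∷ l) F = +ᴾ-congʳ (F (h x)) (∑ᴾ-map h l F)

∑ᴾ-concatMap : ∀ {A B : Set} (H : A → List B) (l : List A) (F : B → Poly) →
  ∑ᴾ (concatMap H l) F ≋ ∑ᴾ l (λ x → ∑ᴾ (H x) F)
∑ᴾ-concatMap H [] F = ≋-refl
∑ᴾ-concatMap H (x ∷ l) F = ≋-trans (∑ᴾ-++ (H x) (concatMap H l) F) (+ᴾ-congʳ (∑ᴾ (H x) F) (∑ᴾ-concatMap H l F))

when : Bool → Poly → Poly
when b p = if b then p else 0ᴾ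

when-cong : ∀ b {p q} → p ≋ q → when b p ≋ when b q
when-cong true e = e
when-cong false e = ≋-refl

when-∧ : ∀ a b p → when a (when b p) ≡ when (a ∧ b) p
when-∧ true b p = refl
when-∧ false b p = refl

when-comm : ∀ a b p → when a (when b p) ≡ when b (when a p)
when-comm true true p = refl
when-comm true false p = refl
when-comm false true p = refl
when-comm false false p = refl

when-+ᴾ : ∀ b p q → when b (p +ᴾ q) ≡ when b p +ᴾ when b q
when-+ᴾ true p q = refl
when-+ᴾ false p q = refl

when-·ᴾ : ∀ b r p → when b (r ·ᴾ p) ≡ r ·ᴾ when b p
when-·ᴾ true r p = refl
when-·ᴾ false r p = refl

when-diffᴾ : ∀ b p q → when b (p -ᴾ q) ≡ when b p -ᴾ when b q
when-diffᴾ true p q = refl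
when-diffᴾ false p q = refl

when-zero : ∀ b {p} → p ≋ 0ᴾ → when b p ≋ 0ᴾ
when-zero true e = e
when-zero false e = ≋-refl

when-cong-if : ∀ b {p q} → (b ≡ true → p ≋ q) → when b p ≋ when b q
when-cong-if true e = e refl
when-cong-if false e = ≋-refl

coeff-when : ∀ b p w → coeff (when b p) w ≡ [ b ]ℚ 1ℚ * coeff p w
coeff-when true p w = sym (ℚP.*-identityˡ (coeff p w))
coeff-when false p w = sym (ℚP.*-zeroˡ (coeff p w))

module _ {A : Set} where

  ∑ᴾ-when-cong : ∀ (l : List A) (b : A → Bool) {F G : A → Poly} →
    (∀ y → b y ≡ true → F y ≋ G y) → ∑ᴾ l (λ y → when (b y) (F y)) ≋ ∑ᴾ l (λ y → when (b y) (G y))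
  ∑ᴾ-when-cong l b {F} {G} h = ∑ᴾ-cong l pointwise
    where
    pointwise : ∀ y → when (b y) (F y) ≋ when (b y) (G y)
    pointwise y with b y in e
    ... | true = h y e
    ... | false = ≋-refl

  ∑ᴾ-when-false : ∀ (l : List A) (b : A → Bool) (F : A → Poly) →
    (∀ y → b y ≡ false) → ∑ᴾ l (λ y → when (b y) (F y)) ≋ 0ᴾ
  ∑ᴾ-when-false l b F h = ∑ᴾ-zero l _ (λ y → ≡⇒≋ (cong (λ c → when c (F y)) (h y)))

  ∑ᴾ-filter : ∀ (b : A → Bool) (P? : ∀ x → Dec (T (b x))) (l : List A) (F : A → Poly) →
    ∑ᴾ (filter P? l) F ≋ ∑ᴾ l (λ y → when (b y) (F y))
  ∑ᴾ-filter b P? [] F = ≋-refl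
  ∑ᴾ-filter b P? (x ∷ l) F with b x | P? x
  ... | true | yes _ = +ᴾ-congʳ (F x) (∑ᴾ-filter b P? l F)
  ... | true | no ¬t = ⊥-elim (¬t tt)
  ... | false | no _ = ∑ᴾ-filter b P? l F
  ... | false | yes ()

∑ᴾ-allFin-suc : ∀ {N} (F : Fin (suc N) → Poly) → ∑ᴾ (allFin (suc N)) F ≋ F zero +ᴾ ∑ᴾ (allFin N) (λ y → F (suc y))
∑ᴾ-allFin-suc {N} F =
  +ᴾ-congʳ (F zero) (≋-trans (≡⇒≋ (cong (λ l → ∑ᴾ l F) (sym (map-tabulate (λ y → y) suc)))) (∑ᴾ-map suc (allFin N) F))

∑ᴾ-allFin-δ : ∀ {N} (π : Fin N) (F : Fin N → Poly) → ∑ᴾ (allFin N) (λ y → when (does (y ≟ π)) (F y)) ≋ F π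
∑ᴾ-allFin-δ {suc N} zero F =
  ≋-trans (∑ᴾ-allFin-suc (λ y → when (does (y ≟ zero)) (F y)))
          (≋-trans (+ᴾ-congʳ (F zero) (∑ᴾ-zero (allFin N) _ (λ _ → ≋-refl))) (+ᴾ-identityʳ (F zero)))
∑ᴾ-allFin-δ {suc N} (suc π) F =
  ≋-trans (∑ᴾ-allFin-suc (λ y → when (does (y ≟ suc π)) (F y))) (∑ᴾ-allFin-δ π (λ y → F (suc y)))

signℚ : ℕ → ℚ
signℚ zero = 1ℚ
signℚ (suc k) = - signℚ k

a-b : Poly
a-b = aᴾ -ᴾ bᴾ

c≋a-b+2b : cᴾ ≋ a-b +ᴾ (bᴾ +ᴾ bᴾ)
c≋a-b+2b = ≈⇒≋ coeffs
  where
  coeffs : ∀ w → coeff cᴾ w ≡ coeff (a-b +ᴾ (bᴾ +ᴾ bᴾ)) w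
  coeffs [] = refl
  coeffs (𝐚 ∷ []) = refl
  coeffs (𝐛 ∷ []) = refl
  coeffs (𝐚 ∷ _ ∷ _) = refl
  coeffs (𝐛 ∷ _ ∷ _) = refl

e≋a-b² : eᴾ ≋ a-b *ᴾ a-b
e≋a-b² = ≈⇒≋ coeffs
  where
  coeffs : ∀ w → coeff eᴾ w ≡ coeff (a-b *ᴾ a-b) w
  coeffs [] = refl
  coeffs (𝐚 ∷ []) = refl
  coeffs (𝐛 ∷ []) = refl
  coeffs (𝐚 ∷ 𝐚 ∷ []) = refl
  coeffs (𝐚 ∷ 𝐛 ∷ []) = refl
  coeffs (𝐛 ∷ 𝐚 ∷ []) = refl
  coeffs (𝐛 ∷ 𝐛 ∷ []) = refl
  coeffs (𝐚 ∷ 𝐚 ∷ _ ∷ _) = refl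
  coeffs (𝐚 ∷ 𝐛 ∷ _ ∷ _) = refl
  coeffs (𝐛 ∷ 𝐚 ∷ _ ∷ _) = refl
  coeffs (𝐛 ∷ 𝐛 ∷ _ ∷ _) = refl

e^≋a-b^2j : ∀ j → eᴾ ^ᴾ j ≋ a-b ^ᴾ (j +ℕ j)
e^≋a-b^2j zero = ≋-refl
e^≋a-b^2j (suc j) rewrite +-suc j j =
  ≋-trans (*ᴾ-cong e≋a-b² (e^≋a-b^2j j)) (*ᴾ-assoc a-b a-b (a-b ^ᴾ (j +ℕ j)))

*ᴾc-expand : ∀ p → p *ᴾ cᴾ ≋ p *ᴾ a-b +ᴾ (p *ᴾ bᴾ +ᴾ p *ᴾ bᴾ)
*ᴾc-expand p = ≋-trans (*ᴾ-congʳ p c≋a-b+2b)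
  (≋-trans (*ᴾ-distribˡ p a-b (bᴾ +ᴾ bᴾ)) (+ᴾ-congʳ (p *ᴾ a-b) (*ᴾ-distribˡ p bᴾ bᴾ)))

c*ᴾ-expand : ∀ p → cᴾ *ᴾ p ≋ a-b *ᴾ p +ᴾ (bᴾ *ᴾ p +ᴾ bᴾ *ᴾ p)
c*ᴾ-expand p = ≋-trans (*ᴾ-congˡ p c≋a-b+2b)
  (≋-trans (*ᴾ-distribʳ a-b (bᴾ +ᴾ bᴾ) p) (+ᴾ-congʳ (a-b *ᴾ p) (*ᴾ-distribʳ bᴾ bᴾ p)))

split-double : ∀ j → split (j +ℕ j) ≡ inj₁ j
split-double zero = refl
split-double (suc j) rewrite +-suc j j | split-double j = refl

signℚ-double : ∀ j → signℚ (j +ℕ j) ≡ 1ℚ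
signℚ-double zero = refl
signℚ-double (suc j) rewrite +-suc j j | signℚ-double j = refl

α-odd : ∀ j → α (suc (j +ℕ j)) ≡ ½ ·ᴾ ((eᴾ ^ᴾ j) *ᴾ cᴾ +ᴾ cᴾ *ᴾ (eᴾ ^ᴾ j))
α-odd j rewrite split-double j = refl

α-even : ∀ j → α (suc (suc (j +ℕ j))) ≡ (- ½) ·ᴾ ((eᴾ ^ᴾ suc j) +ᴾ cᴾ *ᴾ (eᴾ ^ᴾ j) *ᴾ cᴾ)
α-even j rewrite split-double j = refl

module _ (A X Y Z : Poly) where
  private
    P AXX AYY XZZ : Poly
    P = (A +ᴾ X) +ᴾ (Y +ᴾ Z)
    AXX = A +ᴾ (X +ᴾ X)
    AYY = A +ᴾ (Y +ᴾ Y)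
    XZZ = X +ᴾ (Z +ᴾ Z)

    module Coefficients (w : Word) where
      a = coeff A w
      x = coeff X w
      y = coeff Y w
      z = coeff Z w

      c+ : ∀ p q → coeff (p +ᴾ q) w ≡ coeff p w + coeff q w
      c+ p q = coeff-+ᴾ p q w

      c2 : ∀ p q → coeff (p +ᴾ (q +ᴾ q)) w ≡ coeff p w + (coeff q w + coeff q w)
      c2 p q = trans (c+ p (q +ᴾ q)) (cong (coeff p w +_) (c+ q q))

      c-scaled : ∀ s → coeff (s ·ᴾ P -ᴾ Z) w ≡ s * ((a + x) + (y + z)) + (- 1ℚ) * z
      c-scaled s = trans (coeff-diffᴾ (s ·ᴾ P) Z w) (cong (_+ (- 1ℚ) * z)
        (trans (coeff-·ᴾ s P w) (cong (s *_) (trans (c+ (A +ᴾ X) (Y +ᴾ Z)) (cong₂ _+_ (c+ A X) (c+ Y Z))))))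

  even-combination : 1ℚ ·ᴾ P -ᴾ Z ≋ ½ ·ᴾ (AXX +ᴾ AYY)
  even-combination = ≈⇒≋ λ w → let open Coefficients w in begin
    coeff (1ℚ ·ᴾ P -ᴾ Z) w
      ≡⟨ c-scaled 1ℚ ⟩
    1ℚ * ((a + x) + (y + z)) + (- 1ℚ) * z
      ≡⟨ solve 4 (λ a x y z → con 1ℚ :* ((a :+ x) :+ (y :+ z)) :+ con (- 1ℚ) :* z
                            := con ½ :* ((a :+ (x :+ x)) :+ (a :+ (y :+ y)))) refl a x y z ⟩
    ½ * ((a + (x + x)) + (a + (y + y)))
      ≡⟨ sym (trans (coeff-·ᴾ ½ (AXX +ᴾ AYY) w) (cong (½ *_) (trans (c+ AXX AYY) (cong₂ _+_ (c2 A X) (c2 A Y))))) ⟩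
    coeff (½ ·ᴾ (AXX +ᴾ AYY)) w ∎
    where open ≡-Reasoning

  odd-combination : (- 1ℚ) ·ᴾ P -ᴾ Z ≋ (- ½) ·ᴾ (A +ᴾ (AYY +ᴾ (XZZ +ᴾ XZZ)))
  odd-combination = ≈⇒≋ λ w → let open Coefficients w in begin
    coeff ((- 1ℚ) ·ᴾ P -ᴾ Z) w
      ≡⟨ c-scaled (- 1ℚ) ⟩
    (- 1ℚ) * ((a + x) + (y + z)) + (- 1ℚ) * z
      ≡⟨ solve 4 (λ a x y z → con (- 1ℚ) :* ((a :+ x) :+ (y :+ z)) :+ con (- 1ℚ) :* z
                            := con (- ½) :* (a :+ ((a :+ (y :+ y)) :+ ((x :+ (z :+ z)) :+ (x :+ (z :+ z)))))) refl a x y z ⟩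
    (- ½) * (a + ((a + (y + y)) + ((x + (z + z)) + (x + (z + z)))))
      ≡⟨ sym (trans (coeff-·ᴾ (- ½) (A +ᴾ (AYY +ᴾ (XZZ +ᴾ XZZ))) w) (cong ((- ½) *_)
           (trans (c+ A (AYY +ᴾ (XZZ +ᴾ XZZ))) (cong (a +_) (trans (c+ AYY (XZZ +ᴾ XZZ))
             (cong₂ _+_ (c2 A Y) (trans (c+ XZZ XZZ) (cong₂ _+_ (c2 X Z) (c2 X Z))))))))) ⟩
    coeff ((- ½) ·ᴾ (A +ᴾ (AYY +ᴾ (XZZ +ᴾ XZZ)))) w ∎
    where open ≡-Reasoning

-- (a−b)^k + (a−b)^(k−1) b: the two ways a chain leaves an element of corank k, to 1̂ directly or through *.
exitWeight : ℕ → Poly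
exitWeight k = a-b ^ᴾ k +ᴾ a-b ^ᴾ (k ∸ 1) *ᴾ bᴾ

exitCombination-expand : ∀ s k → s ·ᴾ (exitWeight (suc k) +ᴾ bᴾ *ᴾ exitWeight k) -ᴾ bᴾ *ᴾ (a-b ^ᴾ (k ∸ 1) *ᴾ bᴾ)
  ≋ s ·ᴾ ((a-b ^ᴾ suc k +ᴾ a-b ^ᴾ k *ᴾ bᴾ) +ᴾ (bᴾ *ᴾ a-b ^ᴾ k +ᴾ bᴾ *ᴾ (a-b ^ᴾ (k ∸ 1) *ᴾ bᴾ)))
      -ᴾ bᴾ *ᴾ (a-b ^ᴾ (k ∸ 1) *ᴾ bᴾ)
exitCombination-expand s k =
  -ᴾ-cong (·ᴾ-cong s (+ᴾ-congʳ (exitWeight (suc k)) (*ᴾ-distribˡ bᴾ (a-b ^ᴾ k) (a-b ^ᴾ (k ∸ 1) *ᴾ bᴾ)))) ≋-refl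

c-on-both-sides-expand : ∀ k → a-b ^ᴾ k *ᴾ cᴾ +ᴾ cᴾ *ᴾ a-b ^ᴾ k
  ≋ (a-b ^ᴾ suc k +ᴾ (a-b ^ᴾ k *ᴾ bᴾ +ᴾ a-b ^ᴾ k *ᴾ bᴾ)) +ᴾ (a-b ^ᴾ suc k +ᴾ (bᴾ *ᴾ a-b ^ᴾ k +ᴾ bᴾ *ᴾ a-b ^ᴾ k))
c-on-both-sides-expand k =
  +ᴾ-cong (≋-trans (*ᴾc-expand (a-b ^ᴾ k)) (+ᴾ-congˡ _ (≋-sym (^ᴾ-sucʳ a-b k)))) (c*ᴾ-expand (a-b ^ᴾ k))

c-sandwich-expand : ∀ m → cᴾ *ᴾ a-b ^ᴾ m *ᴾ cᴾ
  ≋ (a-b ^ᴾ suc (suc m) +ᴾ (bᴾ *ᴾ a-b ^ᴾ suc m +ᴾ bᴾ *ᴾ a-b ^ᴾ suc m))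
    +ᴾ ((a-b ^ᴾ suc m *ᴾ bᴾ +ᴾ (bᴾ *ᴾ (a-b ^ᴾ m *ᴾ bᴾ) +ᴾ bᴾ *ᴾ (a-b ^ᴾ m *ᴾ bᴾ)))
        +ᴾ (a-b ^ᴾ suc m *ᴾ bᴾ +ᴾ (bᴾ *ᴾ (a-b ^ᴾ m *ᴾ bᴾ) +ᴾ bᴾ *ᴾ (a-b ^ᴾ m *ᴾ bᴾ))))
c-sandwich-expand m = begin
  (cᴾ *ᴾ Dᵐ) *ᴾ cᴾ
    ≈⟨ *ᴾc-expand (cᴾ *ᴾ Dᵐ) ⟩
  (cᴾ *ᴾ Dᵐ) *ᴾ a-b +ᴾ ((cᴾ *ᴾ Dᵐ) *ᴾ bᴾ +ᴾ (cᴾ *ᴾ Dᵐ) *ᴾ bᴾ)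
    ≈⟨ +ᴾ-cong (≋-trans (*ᴾ-congˡ a-b (c*ᴾ-expand Dᵐ)) (*ᴾ-distribʳ-double (a-b ^ᴾ suc m) (bᴾ *ᴾ Dᵐ) a-b))
               (+ᴾ-cong cDᵐb cDᵐb) ⟩
  (a-b ^ᴾ suc m *ᴾ a-b +ᴾ ((bᴾ *ᴾ Dᵐ) *ᴾ a-b +ᴾ (bᴾ *ᴾ Dᵐ) *ᴾ a-b)) +ᴾ (X +ᴾ X)
    ≈⟨ +ᴾ-congˡ (X +ᴾ X) (+ᴾ-cong (≋-sym (^ᴾ-sucʳ a-b (suc m))) (+ᴾ-cong bDᵐD bDᵐD)) ⟩
  (a-b ^ᴾ suc (suc m) +ᴾ (bᴾ *ᴾ a-b ^ᴾ suc m +ᴾ bᴾ *ᴾ a-b ^ᴾ suc m)) +ᴾ (X +ᴾ X) ∎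
  where
  open ≋-Reasoning
  Dᵐ = a-b ^ᴾ m
  X = a-b ^ᴾ suc m *ᴾ bᴾ +ᴾ (bᴾ *ᴾ (Dᵐ *ᴾ bᴾ) +ᴾ bᴾ *ᴾ (Dᵐ *ᴾ bᴾ))
  bDᵐD : (bᴾ *ᴾ Dᵐ) *ᴾ a-b ≋ bᴾ *ᴾ a-b ^ᴾ suc m
  bDᵐD = ≋-trans (*ᴾ-assoc bᴾ Dᵐ a-b) (*ᴾ-congʳ bᴾ (≋-sym (^ᴾ-sucʳ a-b m)))
  cDᵐb : (cᴾ *ᴾ Dᵐ) *ᴾ bᴾ ≋ X
  cDᵐb = ≋-trans (*ᴾ-congˡ bᴾ (c*ᴾ-expand Dᵐ))
           (≋-trans (*ᴾ-distribʳ-double (a-b ^ᴾ suc m) (bᴾ *ᴾ Dᵐ) bᴾ)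
                    (+ᴾ-congʳ (a-b ^ᴾ suc m *ᴾ bᴾ) (+ᴾ-cong (*ᴾ-assoc bᴾ Dᵐ bᴾ) (*ᴾ-assoc bᴾ Dᵐ bᴾ))))

data EvenOrOdd : ℕ → Set where
  even : ∀ j → EvenOrOdd (j +ℕ j)
  odd  : ∀ j → EvenOrOdd (suc (j +ℕ j))

evenOrOdd : ∀ k → EvenOrOdd k
evenOrOdd zero = even zero
evenOrOdd (suc k) with evenOrOdd k
... | even j = odd j
... | odd j rewrite sym (+-suc j j) = even (suc j)

α-identity : ∀ k → signℚ k ·ᴾ (exitWeight (suc k) +ᴾ bᴾ *ᴾ exitWeight k) -ᴾ bᴾ *ᴾ (a-b ^ᴾ (k ∸ 1) *ᴾ bᴾ)
                   ≋ α (suc k)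
α-identity k with evenOrOdd k
... | even j = begin
  signℚ k ·ᴾ W -ᴾ Z
    ≈⟨ -ᴾ-cong (≡⇒≋ (cong (_·ᴾ W) (signℚ-double j))) ≋-refl ⟩
  1ℚ ·ᴾ W -ᴾ Z
    ≈⟨ exitCombination-expand 1ℚ k ⟩
  1ℚ ·ᴾ ((A +ᴾ X) +ᴾ (Y +ᴾ Z)) -ᴾ Z
    ≈⟨ even-combination A X Y Z ⟩
  ½ ·ᴾ ((A +ᴾ (X +ᴾ X)) +ᴾ (A +ᴾ (Y +ᴾ Y)))
    ≈⟨ ·ᴾ-cong ½ (c-on-both-sides-expand k) ⟨
  ½ ·ᴾ (a-b ^ᴾ k *ᴾ cᴾ +ᴾ cᴾ *ᴾ a-b ^ᴾ k)
    ≈⟨ ·ᴾ-cong ½ (+ᴾ-cong (*ᴾ-congˡ cᴾ (e^≋a-b^2j j)) (*ᴾ-congʳ cᴾ (e^≋a-b^2j j))) ⟨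
  ½ ·ᴾ ((eᴾ ^ᴾ j) *ᴾ cᴾ +ᴾ cᴾ *ᴾ (eᴾ ^ᴾ j))
    ≡⟨ α-odd j ⟨
  α (suc k) ∎
  where
  open ≋-Reasoning
  W = exitWeight (suc k) +ᴾ bᴾ *ᴾ exitWeight k
  A = a-b ^ᴾ suc k
  X = a-b ^ᴾ k *ᴾ bᴾ
  Y = bᴾ *ᴾ a-b ^ᴾ k
  Z = bᴾ *ᴾ (a-b ^ᴾ (k ∸ 1) *ᴾ bᴾ)
... | odd j = begin
  signℚ k ·ᴾ W -ᴾ Z
    ≈⟨ -ᴾ-cong (≡⇒≋ (cong (λ s → (- s) ·ᴾ W) (signℚ-double j))) ≋-refl ⟩
  (- 1ℚ) ·ᴾ W -ᴾ Z
    ≈⟨ exitCombination-expand (- 1ℚ) k ⟩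
  (- 1ℚ) ·ᴾ ((A +ᴾ X) +ᴾ (Y +ᴾ Z)) -ᴾ Z
    ≈⟨ odd-combination A X Y Z ⟩
  (- ½) ·ᴾ (A +ᴾ ((A +ᴾ (Y +ᴾ Y)) +ᴾ ((X +ᴾ (Z +ᴾ Z)) +ᴾ (X +ᴾ (Z +ᴾ Z)))))
    ≈⟨ ·ᴾ-cong (- ½) (+ᴾ-cong e^suc≋A (c-sandwich-expand (j +ℕ j))) ⟨
  (- ½) ·ᴾ ((eᴾ ^ᴾ suc j) +ᴾ cᴾ *ᴾ a-b ^ᴾ (j +ℕ j) *ᴾ cᴾ)
    ≈⟨ ·ᴾ-cong (- ½) (+ᴾ-congʳ (eᴾ ^ᴾ suc j) (*ᴾ-congˡ cᴾ (*ᴾ-congʳ cᴾ (e^≋a-b^2j j)))) ⟨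
  (- ½) ·ᴾ ((eᴾ ^ᴾ suc j) +ᴾ cᴾ *ᴾ (eᴾ ^ᴾ j) *ᴾ cᴾ)
    ≡⟨ α-even j ⟨
  α (suc k) ∎
  where
  open ≋-Reasoning
  W = exitWeight (suc k) +ᴾ bᴾ *ᴾ exitWeight k
  A = a-b ^ᴾ suc k
  X = a-b ^ᴾ k *ᴾ bᴾ
  Y = bᴾ *ᴾ a-b ^ᴾ k
  Z = bᴾ *ᴾ (a-b ^ᴾ (j +ℕ j) *ᴾ bᴾ)
  e^suc≋A : eᴾ ^ᴾ suc j ≋ A
  e^suc≋A = ≋-trans (e^≋a-b^2j (suc j)) (≡⇒≋ (cong (λ i → a-b ^ᴾ suc i) (+-suc j j)))

countᵇ : ∀ {A : Set} → (A → Bool) → List A → ℕ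
countᵇ b [] = 0
countᵇ b (x ∷ l) = if b x then suc (countᵇ b l) else countᵇ b l

module _ {A : Set} where

  countᵇ-mono : ∀ (l : List A) {b b' : A → Bool} → (∀ z → b' z ≡ true → b z ≡ true) → countᵇ b' l ≤ countᵇ b l
  countᵇ-mono [] h = z≤n
  countᵇ-mono (x ∷ l) {b} {b'} h with b' x in e' | b x in e
  ... | true | true = s≤s (countᵇ-mono l h)
  ... | true | false with () ← trans (sym (h x e')) e
  ... | false | true = m≤n⇒m≤1+n (countᵇ-mono l h)
  ... | false | false = countᵇ-mono l h

  countᵇ-mono-< : ∀ (l : List A) {b b' : A → Bool} → (∀ z → b' z ≡ true → b z ≡ true) →
    ∀ {w} → w ∈ l → b w ≡ true → b' w ≡ false → countᵇ b' l < countᵇ b l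
  countᵇ-mono-< (x ∷ l) h (here refl) bw b'w rewrite bw | b'w = s≤s (countᵇ-mono l h)
  countᵇ-mono-< (x ∷ l) {b} {b'} h (there w∈l) bw b'w with b' x in e' | b x in e
  ... | true | true = s≤s (countᵇ-mono-< l h w∈l bw b'w)
  ... | true | false with () ← trans (sym (h x e')) e
  ... | false | true = m≤n⇒m≤1+n (countᵇ-mono-< l h w∈l bw b'w)
  ... | false | false = countᵇ-mono-< l h w∈l bw b'w

  countᵇ≡0 : ∀ (l : List A) (b : A → Bool) → countᵇ b l ≡ 0 → ∀ {w} → w ∈ l → b w ≡ false
  countᵇ≡0 (x ∷ l) b e (here refl) with b x
  ... | false = refl
  countᵇ≡0 (x ∷ l) b e (there w∈l) with b x
  ... | false = countᵇ≡0 l b e w∈l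

  countᵇ≢0 : ∀ (l : List A) (b : A → Bool) → countᵇ b l ≢ 0 → ∃ λ w → b w ≡ true
  countᵇ≢0 [] b ne = ⊥-elim (ne refl)
  countᵇ≢0 (x ∷ l) b ne with b x in e
  ... | true = x , e
  ... | false = countᵇ≢0 l b ne

  countᵇ≤length : ∀ (l : List A) (b : A → Bool) → countᵇ b l ≤ length l
  countᵇ≤length [] b = z≤n
  countᵇ≤length (x ∷ l) b with b x
  ... | true = s≤s (countᵇ≤length l b)
  ... | false = m≤n⇒m≤1+n (countᵇ≤length l b)

  length-filter≡countᵇ : ∀ (b : A → Bool) (P? : ∀ x → Dec (T (b x))) (l : List A) →
    length (filter P? l) ≡ countᵇ b l
  length-filter≡countᵇ b P? [] = refl
  length-filter≡countᵇ b P? (x ∷ l) with b x | P? x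
  ... | true | yes _ = cong suc (length-filter≡countᵇ b P? l)
  ... | true | no ¬t = ⊥-elim (¬t tt)
  ... | false | no _ = length-filter≡countᵇ b P? l
  ... | false | yes ()

T⇒≡true : ∀ {b} → T b → b ≡ true
T⇒≡true = Equivalence.to T-≡

≡true⇒T : ∀ {b} → b ≡ true → T b
≡true⇒T = Equivalence.from T-≡

∧-≡true⁻ : ∀ {a b} → (a ∧ b) ≡ true → a ≡ true × b ≡ true
∧-≡true⁻ {true} {true} e = refl , refl

∧-≡true⁺ : ∀ {a b} → a ≡ true → b ≡ true → (a ∧ b) ≡ true
∧-≡true⁺ refl refl = refl

module GradedPosetProperties {n : ℕ} (Λ : GradedPoset n) where
  open GradedPoset Λ public

  ≤ᵇ-refl : ∀ x → le x x ≡ true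
  ≤ᵇ-refl x = T⇒≡true (refl≤ x)

  ≤ᵇ-trans : ∀ {x y z} → le x y ≡ true → le y z ≡ true → le x z ≡ true
  ≤ᵇ-trans {x} {y} {z} p q = T⇒≡true (trans≤ x y z (≡true⇒T p) (≡true⇒T q))

  ≤ᵇ-antisym : ∀ {x y} → le x y ≡ true → le y x ≡ true → x ≡ y
  ≤ᵇ-antisym {x} {y} p q = antisym x y (≡true⇒T p) (≡true⇒T q)

  <ᵇ⇒≤ᵇ : ∀ {x y} → lt x y ≡ true → le x y ≡ true
  <ᵇ⇒≤ᵇ {x} e = proj₁ (∧-≡true⁻ {le x _} e)

  <ᵇ⇒≢ : ∀ {x y} → lt x y ≡ true → x ≢ y
  <ᵇ⇒≢ {x} e refl with x ≟ x | proj₂ (∧-≡true⁻ {le x x} e)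
  ... | yes _ | ()
  ... | no x≢x | _ = x≢x refl

  ≤ᵇ∧≢⇒<ᵇ : ∀ {x y} → le x y ≡ true → x ≢ y → lt x y ≡ true
  ≤ᵇ∧≢⇒<ᵇ {x} {y} p x≢y with x ≟ y
  ... | yes x≡y = ⊥-elim (x≢y x≡y)
  ... | no _ rewrite p = refl

  <ᵇ-irrefl : ∀ x → lt x x ≡ false
  <ᵇ-irrefl x with lt x x in e
  ... | true = ⊥-elim (<ᵇ⇒≢ e refl)
  ... | false = refl

  <ᵇ-≤ᵇ-trans : ∀ {x y z} → lt x y ≡ true → le y z ≡ true → lt x z ≡ true
  <ᵇ-≤ᵇ-trans p q = ≤ᵇ∧≢⇒<ᵇ (≤ᵇ-trans (<ᵇ⇒≤ᵇ p) q) λ { refl → <ᵇ⇒≢ p (≤ᵇ-antisym (<ᵇ⇒≤ᵇ p) q) }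

  <ᵇ-trans : ∀ {x y z} → lt x y ≡ true → lt y z ≡ true → lt x z ≡ true
  <ᵇ-trans p q = <ᵇ-≤ᵇ-trans p (<ᵇ⇒≤ᵇ q)

  <ᵇ⇒≰ᵇ : ∀ {x y} → lt x y ≡ true → le y x ≡ false
  <ᵇ⇒≰ᵇ {x} {y} e with le y x in e'
  ... | true = ⊥-elim (<ᵇ⇒≢ e (≤ᵇ-antisym (<ᵇ⇒≤ᵇ e) e'))
  ... | false = refl

  ≰ᵇ⇒≮ᵇ : ∀ {x y} → le x y ≡ false → lt x y ≡ false
  ≰ᵇ⇒≮ᵇ {x} {y} e with lt x y in e'
  ... | true with () ← trans (sym (<ᵇ⇒≤ᵇ e')) e
  ... | false = refl

  ltH-trans : ∀ {u v w} → ltH u v ≡ true → ltH v w ≡ true → ltH u w ≡ true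
  ltH-trans {el x} {el y} {el z} p q = <ᵇ-trans p q
  ltH-trans {el x} {el y} {one} p q = refl
  ltH-trans {el x} {one} {el z} p ()
  ltH-trans {el x} {one} {one} p ()
  ltH-trans {one} {el y} () q
  ltH-trans {one} {one} () q

  ltH-irrefl : ∀ u → ltH u u ≡ false
  ltH-irrefl (el x) = <ᵇ-irrefl x
  ltH-irrefl one = refl

  leH-trans : ∀ {u v w} → leH u v ≡ true → leH v w ≡ true → leH u w ≡ true
  leH-trans {w = one} p q = refl
  leH-trans {el x} {el y} {el z} p q = ≤ᵇ-trans p q
  leH-trans {one} {el y} {el z} () q
  leH-trans {u} {one} {el z} p ()

  ∈-elemsH : ∀ u → u ∈ elemsH
  ∈-elemsH one = here refl
  ∈-elemsH (el x) = there (∈-map⁺ el (∈-allFin x))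

  strictlyBetween : Hat N → Hat N → ℕ
  strictlyBetween u v = countᵇ (λ z → ltH u z ∧ ltH z v) elemsH

  -- Induction on the number of elements strictly between u and v: with none, v covers u.
  rkH-mono-< : ∀ {u v} → ltH u v ≡ true → rkH u < rkH v
  rkH-mono-< {u} {v} e = go (strictlyBetween u v) {u} {v} ≤-refl e
    where
    go : ∀ m {u v} → strictlyBetween u v ≤ m → ltH u v ≡ true → rkH u < rkH v
    go m {u} {v} bound e with strictlyBetween u v ≟ℕ 0
    ... | yes none = subst (rkH u <_) (sym (rk-cover u v (≡true⇒T e , noneBetween))) (n<1+n (rkH u))
      where
      noneBetween : ∀ z → ¬ (T (ltH u z) × T (ltH z v))
      noneBetween z (p , q) with () ← trans (sym (∧-≡true⁺ {ltH u z} (T⇒≡true p) (T⇒≡true q)))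
                                           (countᵇ≡0 elemsH _ none (∈-elemsH z))
    ... | no some with m | countᵇ≢0 elemsH (λ z → ltH u z ∧ ltH z v) some
    ...   | zero | _ = ⊥-elim (some (n≤0⇒n≡0 bound))
    ...   | suc m | z , between = <-trans (go m {u} {z} (shrink uzFewer) uz) (go m {z} {v} (shrink zvFewer) zv)
      where
      uz = proj₁ (∧-≡true⁻ {ltH u z} between)
      zv = proj₂ (∧-≡true⁻ {ltH u z} between)
      shrink : ∀ {k} → k < strictlyBetween u v → k ≤ m
      shrink k< = ≤-pred (≤-trans k< bound)
      uzFewer : strictlyBetween u z < strictlyBetween u v
      uzFewer = countᵇ-mono-< elemsH
        (λ w h → ∧-≡true⁺ (proj₁ (∧-≡true⁻ {ltH u w} h)) (ltH-trans {w} {z} {v} (proj₂ (∧-≡true⁻ {ltH u w} h)) zv))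
        (∈-elemsH z) between (cong (ltH u z ∧_) (ltH-irrefl z) ⟨ trans ⟩ ∧-zeroʳ (ltH u z))
      zvFewer : strictlyBetween z v < strictlyBetween u v
      zvFewer = countᵇ-mono-< elemsH
        (λ w h → ∧-≡true⁺ (ltH-trans {u} {z} {w} uz (proj₁ (∧-≡true⁻ {ltH z w} h))) (proj₂ (∧-≡true⁻ {ltH z w} h)))
        (∈-elemsH z) between (cong (_∧ ltH z v) (ltH-irrefl z))

  rk-mono-< : ∀ {x y} → lt x y ≡ true → rk x < rk y
  rk-mono-< {x} {y} e = rkH-mono-< {el x} {el y} e

  rk-mono-≤ : ∀ {x y} → le x y ≡ true → rk x ≤ rk y
  rk-mono-≤ {x} {y} e with x ≟ y
  ... | yes refl = ≤-refl
  ... | no x≢y = <⇒≤ (rk-mono-< (≤ᵇ∧≢⇒<ᵇ e x≢y))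

  rk≤n : ∀ x → rk x ≤ n
  rk≤n x = ≤-pred (rkH-mono-< {el x} {one} refl)

gap : ℕ → ℕ → Poly
gap r s = a-b ^ᴾ ((s ∸ r) ∸ 1)

module ChainSums {n : ℕ} (Λ : GradedPoset n) where
  open GradedPosetProperties Λ

  link : Fin N → Fin N → Poly
  link x y = gap (rk x) (rk y) *ᴾ bᴾ

  -- The sum, over chains x < y₁ < ⋯ < yⱼ of elements satisfying p with j ≤ k,
  -- of link x y₁ · link y₁ y₂ ⋯ f yⱼ.
  chainSum : (Fin N → Bool) → (Fin N → Poly) → ℕ → Fin N → Poly
  chainSum p f zero x = f x
  chainSum p f (suc k) x = f x +ᴾ ∑ᴾ (allFin N) (λ y → when (p y ∧ lt x y) (link x y *ᴾ chainSum p f k y))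

  everything : Fin N → Bool
  everything _ = true

  above : (Fin N → Bool) → Fin N → ℕ
  above p x = countᵇ (λ z → p z ∧ lt x z) (allFin N)

  above-<ᵇ : ∀ p {x y} → p y ≡ true → lt x y ≡ true → above p y < above p x
  above-<ᵇ p {x} {y} py x<y = countᵇ-mono-< (allFin N)
    (λ z h → ∧-≡true⁺ (proj₁ (∧-≡true⁻ {p z} h)) (<ᵇ-trans x<y (proj₂ (∧-≡true⁻ {p z} h))))
    (∈-allFin y) (∧-≡true⁺ py x<y) (cong (p y ∧_) (<ᵇ-irrefl y) ⟨ trans ⟩ ∧-zeroʳ (p y))

  above-step : ∀ p {x y k} → (p y ∧ lt x y) ≡ true → above p x ≤ suc k → above p y ≤ k
  above-step p {y = y} e bound =
    ≤-pred (≤-trans (above-<ᵇ p (proj₁ (∧-≡true⁻ {p y} e)) (proj₂ (∧-≡true⁻ {p y} e))) bound)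

  above≡0 : ∀ p x → above p x ≡ 0 → ∀ y → (p y ∧ lt x y) ≡ false
  above≡0 p x e y = countᵇ≡0 (allFin N) (λ z → p z ∧ lt x z) e (∈-allFin y)

  above≤count : ∀ p x → above p x ≤ countᵇ p (allFin N)
  above≤count p x = countᵇ-mono (allFin N) (λ z h → proj₁ (∧-≡true⁻ {p z} h))

  above≤N : ∀ p x → above p x ≤ N
  above≤N p x = ≤-trans (above≤count p x)
    (subst (countᵇ p (allFin N) ≤_) (length-tabulate (λ y → y)) (countᵇ≤length (allFin N) p))

  chainSum-maximal : ∀ p f k x → above p x ≡ 0 → chainSum p f k x ≋ f x
  chainSum-maximal p f zero x e = ≋-refl
  chainSum-maximal p f (suc k) x e =
    ≋-trans (+ᴾ-congʳ (f x) (∑ᴾ-when-false (allFin N) _ _ (above≡0 p x e))) (+ᴾ-identityʳ (f x))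

  chainSum-stable : ∀ p f k k' x → above p x ≤ k → above p x ≤ k' → chainSum p f k x ≋ chainSum p f k' x
  chainSum-stable p f zero k' x h h' = ≋-sym (chainSum-maximal p f k' x (n≤0⇒n≡0 h))
  chainSum-stable p f (suc k) zero x h h' = chainSum-maximal p f (suc k) x (n≤0⇒n≡0 h')
  chainSum-stable p f (suc k) (suc k') x h h' =
    +ᴾ-congʳ (f x) (∑ᴾ-when-cong (allFin N) (λ y → p y ∧ lt x y) (λ y e →
      *ᴾ-congʳ (link x y) (chainSum-stable p f k k' y (above-step p e h) (above-step p e h'))))

  chainSum-cong : ∀ p {f f'} → (∀ z → f z ≋ f' z) → ∀ k x → chainSum p f k x ≋ chainSum p f' k x
  chainSum-cong p e zero x = e x
  chainSum-cong p e (suc k) x = +ᴾ-cong (e x) (∑ᴾ-cong (allFin N) (λ y →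
    when-cong (p y ∧ lt x y) (*ᴾ-congʳ (link x y) (chainSum-cong p e k y))))

  chainSum-zero : ∀ p k x → chainSum p (λ _ → 0ᴾ) k x ≋ 0ᴾ
  chainSum-zero p zero x = ≋-refl
  chainSum-zero p (suc k) x = ∑ᴾ-zero (allFin N) _ (λ y →
    when-zero (p y ∧ lt x y) (≋-trans (*ᴾ-congʳ (link x y) (chainSum-zero p k y)) (*ᴾ-zeroʳ (link x y))))

  chainSum-+ : ∀ p f f' k x → chainSum p (λ z → f z +ᴾ f' z) k x ≋ chainSum p f k x +ᴾ chainSum p f' k x
  chainSum-+ p f f' zero x = ≋-refl
  chainSum-+ p f f' (suc k) x = ≋-trans
    (+ᴾ-congʳ (f x +ᴾ f' x) (≋-trans (∑ᴾ-cong (allFin N) distribute) (∑ᴾ-+ (allFin N) _ _)))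
    (+ᴾ-medial (f x) (f' x) _ _)
    where
    distribute : ∀ y → when (p y ∧ lt x y) (link x y *ᴾ chainSum p (λ z → f z +ᴾ f' z) k y)
                     ≋ when (p y ∧ lt x y) (link x y *ᴾ chainSum p f k y) +ᴾ when (p y ∧ lt x y) (link x y *ᴾ chainSum p f' k y)
    distribute y = ≋-trans (when-cong (p y ∧ lt x y) (≋-trans (*ᴾ-congʳ (link x y) (chainSum-+ p f f' k y))
                                                                (*ᴾ-distribˡ (link x y) _ _)))
                           (≡⇒≋ (when-+ᴾ (p y ∧ lt x y) _ _))

  chainSum-· : ∀ p r f k x → chainSum p (λ z → r ·ᴾ f z) k x ≋ r ·ᴾ chainSum p f k x
  chainSum-· p r f zero x = ≋-refl
  chainSum-· p r f (suc k) x = ≋-trans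
    (+ᴾ-congʳ (r ·ᴾ f x) (≋-trans (∑ᴾ-cong (allFin N) scale) (∑ᴾ-· (allFin N) r _)))
    (≋-sym (·ᴾ-distrib-+ᴾ r (f x) _))
    where
    scale : ∀ y → when (p y ∧ lt x y) (link x y *ᴾ chainSum p (λ z → r ·ᴾ f z) k y)
                  ≋ r ·ᴾ when (p y ∧ lt x y) (link x y *ᴾ chainSum p f k y)
    scale y = ≋-trans (when-cong (p y ∧ lt x y) (≋-trans (*ᴾ-congʳ (link x y) (chainSum-· p r f k y))
                                                          (*ᴾ-·ᴾʳ r (link x y) _)))
                      (≡⇒≋ (when-·ᴾ (p y ∧ lt x y) r _))

  chainSum-diff : ∀ p f f' k x → chainSum p (λ z → f z -ᴾ f' z) k x ≋ chainSum p f k x -ᴾ chainSum p f' k x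
  chainSum-diff p f f' k x =
    ≋-trans (chainSum-+ p f (λ z → (- 1ℚ) ·ᴾ f' z) k x) (+ᴾ-congʳ _ (chainSum-· p (- 1ℚ) f' k x))

  chainSum-when : ∀ p c f k x → chainSum p (λ z → when c (f z)) k x ≋ when c (chainSum p f k x)
  chainSum-when p true f k x = ≋-refl
  chainSum-when p false f k x = chainSum-zero p k x

  chainSum-∑ᴾ : ∀ {A : Set} p (l : List A) (F : A → Fin N → Poly) k x →
    chainSum p (λ z → ∑ᴾ l (λ a → F a z)) k x ≋ ∑ᴾ l (λ a → chainSum p (F a) k x)
  chainSum-∑ᴾ p [] F k x = chainSum-zero p k x
  chainSum-∑ᴾ p (a ∷ l) F k x = ≋-trans (chainSum-+ p (F a) _ k x) (+ᴾ-congʳ _ (chainSum-∑ᴾ p l F k x))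

  chainSum-∑ᴾ-diff : ∀ {A : Set} p (l : List A) (F G : A → Fin N → Poly) k x →
    chainSum p (λ z → ∑ᴾ l (λ a → F a z) -ᴾ ∑ᴾ l (λ a → G a z)) k x
      ≋ ∑ᴾ l (λ a → chainSum p (F a) k x -ᴾ chainSum p (G a) k x)
  chainSum-∑ᴾ-diff p l F G k x =
    ≋-trans (chainSum-diff p (λ z → ∑ᴾ l (λ a → F a z)) (λ z → ∑ᴾ l (λ a → G a z)) k x)
            (≋-trans (-ᴾ-cong (chainSum-∑ᴾ p l F k x) (chainSum-∑ᴾ p l G k x)) (≋-sym (∑ᴾ-diff l _ _)))

  DownClosed : (Fin N → Bool) → Set
  DownClosed q = ∀ {y z} → lt y z ≡ true → q z ≡ true → q y ≡ true

  chainSum-outside : ∀ q → DownClosed q → ∀ f → (∀ z → q z ≡ false → f z ≋ 0ᴾ) →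
    ∀ k y → q y ≡ false → chainSum everything f k y ≋ 0ᴾ
  chainSum-outside q closed f f0 zero y qy = f0 y qy
  chainSum-outside q closed f f0 (suc k) y qy = +ᴾ-cong (f0 y qy) (∑ᴾ-zero (allFin N) _ vanish)
    where
    vanish : ∀ z → when (lt y z) (link y z *ᴾ chainSum everything f k z) ≋ 0ᴾ
    vanish z with lt y z in y<z | q z in qz
    ... | false | _ = ≋-refl
    ... | true | false = ≋-trans (*ᴾ-congʳ (link y z) (chainSum-outside q closed f f0 k z qz)) (*ᴾ-zeroʳ (link y z))
    ... | true | true with () ← trans (sym (closed y<z qz)) qy

  chainSum-restrict : ∀ q → DownClosed q → ∀ f k x → q x ≡ true →
    chainSum q f k x ≋ chainSum everything (λ z → when (q z) (f z)) k x
  chainSum-restrict q closed f zero x qx rewrite qx = ≋-refl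
  chainSum-restrict q closed f (suc k) x qx rewrite qx = +ᴾ-congʳ (f x) (∑ᴾ-cong (allFin N) pointwise)
    where
    pointwise : ∀ y → when (q y ∧ lt x y) (link x y *ᴾ chainSum q f k y)
                    ≋ when (lt x y) (link x y *ᴾ chainSum everything (λ z → when (q z) (f z)) k y)
    pointwise y with q y in qy
    ... | true = when-cong (lt x y) (*ᴾ-congʳ (link x y) (chainSum-restrict q closed f k y qy))
    ... | false = ≋-sym (when-zero (lt x y) (≋-trans (*ᴾ-congʳ (link x y)
                    (chainSum-outside q closed _ (λ z qz → ≡⇒≋ (cong (λ c → when c (f z)) qz)) k y qy))
                    (*ᴾ-zeroʳ (link x y))))

  module _ (π : Fin N) (f : Fin N → Poly) (f0 : ∀ τ → le τ π ≡ false → f τ ≋ 0ᴾ) where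

    private
      ≤π-closed : DownClosed (λ z → le z π)
      ≤π-closed y<z z≤π = ≤ᵇ-trans (<ᵇ⇒≤ᵇ y<z) z≤π

      chainSum-≰π : ∀ k y → le y π ≡ false → chainSum everything f k y ≋ 0ᴾ
      chainSum-≰π = chainSum-outside (λ z → le z π) ≤π-closed f f0

    chainSum-from-top : ∀ k → chainSum everything f k π ≋ f π
    chainSum-from-top zero = ≋-refl
    chainSum-from-top (suc k) = ≋-trans (+ᴾ-congʳ (f π) (∑ᴾ-zero (allFin N) _ vanish)) (+ᴾ-identityʳ (f π))
      where
      vanish : ∀ y → when (lt π y) (link π y *ᴾ chainSum everything f k y) ≋ 0ᴾ
      vanish y with lt π y in π<y
      ... | true = ≋-trans (*ᴾ-congʳ (link π y) (chainSum-≰π k y (<ᵇ⇒≰ᵇ π<y))) (*ᴾ-zeroʳ (link π y))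
      ... | false = ≋-refl

    -- A chain from x < π either jumps to π or its next element lies below π.
    ∑ᴾ-successors-split : ∀ k x → lt x π ≡ true →
      ∑ᴾ (allFin N) (λ y → when (lt x y) (link x y *ᴾ chainSum everything f k y))
        ≋ link x π *ᴾ f π +ᴾ ∑ᴾ (allFin N) (λ y → when (lt y π ∧ lt x y) (link x y *ᴾ chainSum everything f k y))
    ∑ᴾ-successors-split k x x<π =
      ≋-trans (∑ᴾ-cong (allFin N) pointwise)
        (≋-trans (∑ᴾ-+ (allFin N) (λ y → when (does (y ≟ π)) (link x π *ᴾ chainSum everything f k π)) _)
                 (+ᴾ-congˡ _ (≋-trans (∑ᴾ-allFin-δ π _) (*ᴾ-congʳ (link x π) (chainSum-from-top k)))))
      where
      pointwise : ∀ y → when (lt x y) (link x y *ᴾ chainSum everything f k y)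
                      ≋ when (does (y ≟ π)) (link x π *ᴾ chainSum everything f k π)
                        +ᴾ when (lt y π ∧ lt x y) (link x y *ᴾ chainSum everything f k y)
      pointwise y with y ≟ π
      ... | yes refl rewrite x<π | ∧-zeroʳ (le y y) = ≋-sym (+ᴾ-identityʳ _)
      ... | no y≢π with le y π in y≤π
      ...   | true rewrite ≤ᵇ∧≢⇒<ᵇ y≤π y≢π = ≋-refl
      ...   | false rewrite ≰ᵇ⇒≮ᵇ y≤π =
                when-zero (lt x y) (≋-trans (*ᴾ-congʳ (link x y) (chainSum-≰π k y y≤π)) (*ᴾ-zeroʳ (link x y)))

    -- A chain stopping at τ < π weighs gap τ π · P, one stopping at π ends in link · f π = gap · b f π.
    chainSum-through : ∀ P → (∀ τ → lt τ π ≡ true → f τ ≋ gap (rk τ) (rk π) *ᴾ P) →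
      ∀ k x → lt x π ≡ true → above (λ z → lt z π) x ≤ k →
      chainSum everything f (suc k) x
        ≋ chainSum (λ z → lt z π) (λ z → gap (rk z) (rk π)) k x *ᴾ (P +ᴾ bᴾ *ᴾ f π)
    chainSum-through P f<π k x x<π bound =
      ≋-trans (+ᴾ-congʳ (f x) (∑ᴾ-successors-split k x x<π))
              (≋-trans (≋-sym (+ᴾ-assoc (f x) (link x π *ᴾ f π) (rest k))) (combine k bound))
      where
      Q = P +ᴾ bᴾ *ᴾ f π
      ψ : ℕ → Fin N → Poly
      ψ = chainSum (λ z → lt z π) (λ z → gap (rk z) (rk π))
      rest : ℕ → Poly
      rest k = ∑ᴾ (allFin N) (λ y → when (lt y π ∧ lt x y) (link x y *ᴾ chainSum everything f k y))
      direct : f x +ᴾ link x π *ᴾ f π ≋ gap (rk x) (rk π) *ᴾ Q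
      direct = ≋-trans (+ᴾ-cong (f<π x x<π) (*ᴾ-assoc (gap (rk x) (rk π)) bᴾ (f π)))
                       (≋-sym (*ᴾ-distribˡ (gap (rk x) (rk π)) P (bᴾ *ᴾ f π)))
      combine : ∀ k → above (λ z → lt z π) x ≤ k → (f x +ᴾ link x π *ᴾ f π) +ᴾ rest k ≋ ψ k x *ᴾ Q
      combine zero bound =
        ≋-trans (+ᴾ-cong direct (∑ᴾ-when-false (allFin N) _ _ (above≡0 (λ z → lt z π) x (n≤0⇒n≡0 bound))))
                (+ᴾ-identityʳ _)
      combine (suc k) bound = ≋-sym (≋-trans (*ᴾ-distribʳ (gap (rk x) (rk π)) _ Q)
        (+ᴾ-cong (≋-sym direct) (≋-trans (∑ᴾ-*ʳ (allFin N) _ Q) (∑ᴾ-cong (allFin N) pointwise))))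
        where
        pointwise : ∀ y → when (lt y π ∧ lt x y) (link x y *ᴾ ψ k y) *ᴾ Q
                        ≋ when (lt y π ∧ lt x y) (link x y *ᴾ chainSum everything f (suc k) y)
        pointwise y with lt y π ∧ lt x y in e
        ... | true = ≋-trans (*ᴾ-assoc (link x y) (ψ k y) Q) (*ᴾ-congʳ (link x y) (≋-sym
                       (chainSum-through P f<π k y (proj₁ (∧-≡true⁻ {lt y π} e))
                                                    (above-step (λ z → lt z π) e bound))))
        ... | false = ≋-refl

module _ {E : Set} (elems : List E) (ltE : E → E → Bool) (rkE : E → ℕ) (top : ℕ) where
  open ABIndex elems ltE rkE using (chainsAbove; wtFrom)

  chainsFrom : ℕ → E → Poly
  chainsFrom k x = ∑ᴾ (chainsAbove k x) (wtFrom top x)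

  chainsFrom-zero : ∀ x → chainsFrom 0 x ≋ gap (rkE x) top
  chainsFrom-zero x = +ᴾ-identityʳ (gap (rkE x) top)

  chainsFrom-suc : ∀ k x → chainsFrom (suc k) x
    ≋ gap (rkE x) top +ᴾ ∑ᴾ elems (λ y → when (ltE x y) (gap (rkE x) (rkE y) *ᴾ bᴾ *ᴾ chainsFrom k y))
  chainsFrom-suc k x = +ᴾ-congʳ (gap (rkE x) top) (successors _)
    where
    extend : E → List (List E)
    extend y = map (y ∷_) (chainsAbove k y)
    -- Stated for every decision procedure, as ABIndex filters with one local to a where-block.
    successors : (P? : ∀ y → Dec (T (ltE x y))) →
      ∑ᴾ (concatMap extend (filter P? elems)) (wtFrom top x)
        ≋ ∑ᴾ elems (λ y → when (ltE x y) (gap (rkE x) (rkE y) *ᴾ bᴾ *ᴾ chainsFrom k y))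
    successors P? =
      ≋-trans (∑ᴾ-concatMap extend (filter P? elems) (wtFrom top x))
        (≋-trans (∑ᴾ-cong (filter P? elems) (λ y →
                    ≋-trans (∑ᴾ-map (y ∷_) (chainsAbove k y) (wtFrom top x))
                            (≋-sym (∑ᴾ-*ˡ (chainsAbove k y) (wtFrom top y) (gap (rkE x) (rkE y) *ᴾ bᴾ)))))
                 (∑ᴾ-filter (ltE x) P? elems _))

module _ {n : ℕ} (Λ : GradedPoset n) where
  open GradedPosetProperties Λ
  open ChainSums Λ

  chainsFrom-below-π : ∀ π (P? : ∀ σ → Dec (T (lt σ π))) k x →
    chainsFrom (filter P? (allFin N)) lt rk (rk π) k x ≋ chainSum (λ z → lt z π) (λ z → gap (rk z) (rk π)) k x
  chainsFrom-below-π π P? zero x = chainsFrom-zero (filter P? (allFin N)) lt rk (rk π) x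
  chainsFrom-below-π π P? (suc k) x =
    ≋-trans (chainsFrom-suc (filter P? (allFin N)) lt rk (rk π) k x)
      (+ᴾ-congʳ (gap (rk x) (rk π)) (≋-trans (∑ᴾ-filter (λ σ → lt σ π) P? (allFin N) _)
        (∑ᴾ-cong (allFin N) (λ y → ≋-trans (≡⇒≋ (when-∧ (lt y π) (lt x y) _))
          (when-cong (lt y π ∧ lt x y) (*ᴾ-congʳ (link x y) (chainsFrom-below-π π P? k y)))))))

  Ψ-below≋chainSum : ∀ π (P? : ∀ σ → Dec (T (lt σ π))) →
    ABIndex.Ψ (filter P? (allFin N)) lt rk bot (rk π) ≋ chainSum (λ z → lt z π) (λ z → gap (rk z) (rk π)) N bot
  Ψ-below≋chainSum π P? =
    ≋-trans (chainsFrom-below-π π P? (length (filter P? (allFin N))) bot)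
            (chainSum-stable (λ z → lt z π) _ _ N bot enoughFuel (above≤N (λ z → lt z π) bot))
    where
    enoughFuel : above (λ z → lt z π) bot ≤ length (filter P? (allFin N))
    enoughFuel = subst (above (λ z → lt z π) bot ≤_) (sym (length-filter≡countᵇ (λ σ → lt σ π) P? (allFin N)))
                       (above≤count (λ z → lt z π) bot)

ℤ→ℚ : ℤ → ℚ
ℤ→ℚ (ℤ.+ zero) = 0ℚ
ℤ→ℚ (ℤ.+ suc m) = 1ℚ + ℤ→ℚ (ℤ.+ m)
ℤ→ℚ ℤ.-[1+ zero ] = - 1ℚ
ℤ→ℚ ℤ.-[1+ suc m ] = - 1ℚ + ℤ→ℚ ℤ.-[1+ m ]

ℤ→ℚ-1ℤ+ : ∀ z → ℤ→ℚ (ℤ.1ℤ ℤ.+ z) ≡ 1ℚ + ℤ→ℚ z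
ℤ→ℚ-1ℤ+ (ℤ.+ m) = refl
ℤ→ℚ-1ℤ+ ℤ.-[1+ zero ] = refl
ℤ→ℚ-1ℤ+ ℤ.-[1+ suc m ] = solve 1 (λ x → x := con 1ℚ :+ (con (- 1ℚ) :+ x)) refl (ℤ→ℚ ℤ.-[1+ m ])

ℤ→ℚ-‿1ℤ+ : ∀ z → ℤ→ℚ (ℤ.-1ℤ ℤ.+ z) ≡ - 1ℚ + ℤ→ℚ z
ℤ→ℚ-‿1ℤ+ (ℤ.+ zero) = refl
ℤ→ℚ-‿1ℤ+ (ℤ.+ suc m) = solve 1 (λ x → x := con (- 1ℚ) :+ (con 1ℚ :+ x)) refl (ℤ→ℚ (ℤ.+ m))
ℤ→ℚ-‿1ℤ+ ℤ.-[1+ m ] = refl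

sign-double : ∀ j → sign (j +ℕ j) ≡ ℤ.1ℤ
sign-double zero = refl
sign-double (suc j) rewrite +-suc j j | sign-double j = refl

ℤ→ℚ-sign+ : ∀ k z → ℤ→ℚ (sign k ℤ.+ z) ≡ signℚ k + ℤ→ℚ z
ℤ→ℚ-sign+ k z with evenOrOdd k
... | even j rewrite sign-double j | signℚ-double j = ℤ→ℚ-1ℤ+ z
... | odd j rewrite sign-double j | signℚ-double j = ℤ→ℚ-‿1ℤ+ z

signℚ-+ : ∀ a b → signℚ (a +ℕ b) ≡ signℚ a * signℚ b
signℚ-+ zero b = sym (ℚP.*-identityˡ (signℚ b))
signℚ-+ (suc a) b = trans (cong -_ (signℚ-+ a b)) (ℚP.neg-distribˡ-* (signℚ a) (signℚ b))

signℚ-square : ∀ a → signℚ a * signℚ a ≡ 1ℚ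
signℚ-square zero = refl
signℚ-square (suc a) = trans (solve 1 (λ x → (:- x) :* (:- x) := x :* x) refl (signℚ a)) (signℚ-square a)

ℤ→ℚ-Σsign : ∀ {A : Set} (l : List A) (f : A → ℕ) →
  ℤ→ℚ (foldr ℤ._+_ ℤ.0ℤ (map (λ x → sign (f x)) l)) ≡ Σℚ l (λ x → signℚ (f x))
ℤ→ℚ-Σsign [] f = refl
ℤ→ℚ-Σsign (x ∷ l) f = trans (ℤ→ℚ-sign+ (f x) _) (cong (signℚ (f x) +_) (ℤ→ℚ-Σsign l f))

Σℚ-filter : ∀ {A : Set} (b : A → Bool) (P? : ∀ x → Dec (T (b x))) (l : List A) (g : A → ℚ) →
  Σℚ (filter P? l) g ≡ Σℚ l (λ x → [ b x ]ℚ (g x))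
Σℚ-filter b P? [] g = refl
Σℚ-filter b P? (x ∷ l) g with b x | P? x
... | true | yes _ = cong (g x +_) (Σℚ-filter b P? l g)
... | true | no ¬t = ⊥-elim (¬t tt)
... | false | no _ = trans (Σℚ-filter b P? l g) (sym (ℚP.+-identityˡ _))
... | false | yes ()

suc∸-split : ∀ {a b m} → a ≤ b → b ≤ m → suc m ∸ a ≡ suc (m ∸ b) +ℕ (b ∸ a)
suc∸-split {b = b} z≤n b≤m = cong suc (sym (m∸n+n≡m b≤m))
suc∸-split (s≤s a≤b) (s≤s b≤m) = suc∸-split a≤b b≤m

∸-through : ∀ {t r m} → t < r → r ≤ m → m ∸ t ≡ ((r ∸ t) ∸ 1) +ℕ suc (m ∸ r)
∸-through {zero} {suc r} {suc m} _ (s≤s r≤m) = sym (trans (+-suc r (m ∸ r)) (cong suc (m+[n∸m]≡n r≤m)))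
∸-through {suc t} {suc r} {suc m} (s≤s t<r) (s≤s r≤m) = ∸-through t<r r≤m

module EulerianProperties {n : ℕ} (Λ : GradedPoset n) (eulerian : IsEulerian Λ) where
  open GradedPosetProperties Λ

  signed-sum-to-1̂ : ∀ τ →
    signℚ (suc n ∸ rk τ) + Σℚ (allFin N) (λ π → [ le τ π ]ℚ (signℚ (rk π ∸ rk τ))) ≡ 0ℚ
  signed-sum-to-1̂ τ = fromℤ _ (eulerian (el τ) one tt)
    where
    open ≡-Reasoning
    fromℤ : (P? : ∀ σ → Dec (T (leH (el τ) σ ∧ leH σ one))) →
      sign (suc n ∸ rk τ) ℤ.+ foldr ℤ._+_ ℤ.0ℤ (map (λ σ → sign (rkH σ ∸ rk τ)) (filter P? (map el (allFin N))))
        ≡ ℤ.0ℤ →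
      signℚ (suc n ∸ rk τ) + Σℚ (allFin N) (λ π → [ le τ π ]ℚ (signℚ (rk π ∸ rk τ))) ≡ 0ℚ
    fromℤ P? e = begin
      signℚ (suc n ∸ rk τ) + Σℚ (allFin N) (λ π → [ le τ π ]ℚ (signℚ (rk π ∸ rk τ)))
        ≡⟨ cong (signℚ (suc n ∸ rk τ) +_) (Σℚ-cong (allFin N) (λ π →
             cong (λ b → [ b ]ℚ (signℚ (rk π ∸ rk τ))) (sym (∧-identityʳ (le τ π))))) ⟩
      signℚ (suc n ∸ rk τ) + Σℚ (allFin N) (λ π → [ le τ π ∧ true ]ℚ (signℚ (rk π ∸ rk τ)))
        ≡⟨ cong (signℚ (suc n ∸ rk τ) +_) (sym (trans (Σℚ-filter _ P? (map el (allFin N)) _)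
                                                      (Σℚ-map el (allFin N) _))) ⟩
      signℚ (suc n ∸ rk τ) + Σℚ (filter P? (map el (allFin N))) (λ σ → signℚ (rkH σ ∸ rk τ))
        ≡⟨ cong (signℚ (suc n ∸ rk τ) +_) (sym (ℤ→ℚ-Σsign (filter P? (map el (allFin N))) (λ σ → rkH σ ∸ rk τ))) ⟩
      signℚ (suc n ∸ rk τ) + ℤ→ℚ (foldr ℤ._+_ ℤ.0ℤ (map (λ σ → sign (rkH σ ∸ rk τ)) (filter P? (map el (allFin N)))))
        ≡⟨ sym (ℤ→ℚ-sign+ (suc n ∸ rk τ) _) ⟩
      ℤ→ℚ (sign (suc n ∸ rk τ) ℤ.+ foldr ℤ._+_ ℤ.0ℤ (map (λ σ → sign (rkH σ ∸ rk τ)) (filter P? (map el (allFin N)))))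
        ≡⟨ cong ℤ→ℚ e ⟩
      0ℚ ∎

  signed-upper-sum : ∀ τ → Σℚ (allFin N) (λ π → [ le τ π ]ℚ (signℚ (n ∸ rk π))) ≡ 1ℚ
  signed-upper-sum τ = begin
    Σℚ (allFin N) (λ π → [ le τ π ]ℚ (signℚ (n ∸ rk π)))
      ≡⟨ Σℚ-cong (allFin N) rebase ⟩
    Σℚ (allFin N) (λ π → (- c) * [ le τ π ]ℚ (t π))
      ≡⟨ Σℚ-*ˡ (allFin N) (- c) _ ⟩
    (- c) * X
      ≡⟨ cong ((- c) *_) X≡-c ⟩
    (- c) * (- c)
      ≡⟨ solve 1 (λ x → (:- x) :* (:- x) := x :* x) refl c ⟩
    c * c
      ≡⟨ signℚ-square (suc n ∸ rk τ) ⟩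
    1ℚ ∎
    where
    open ≡-Reasoning
    c = signℚ (suc n ∸ rk τ)
    t : Fin N → ℚ
    t π = signℚ (rk π ∸ rk τ)
    X = Σℚ (allFin N) (λ π → [ le τ π ]ℚ (t π))
    X≡-c : X ≡ - c
    X≡-c = trans (solve 2 (λ x y → y := (:- x) :+ (x :+ y)) refl c X)
                 (trans (cong ((- c) +_) (signed-sum-to-1̂ τ)) (ℚP.+-identityʳ (- c)))
    suc-n∸rkτ : ∀ {π} → le τ π ≡ true → suc n ∸ rk τ ≡ suc (n ∸ rk π) +ℕ (rk π ∸ rk τ)
    suc-n∸rkτ {π} τ≤π = suc∸-split (rk-mono-≤ τ≤π) (rk≤n π)
    rebase : ∀ π → [ le τ π ]ℚ (signℚ (n ∸ rk π)) ≡ (- c) * [ le τ π ]ℚ (t π)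
    rebase π with le τ π in τ≤π
    ... | false = sym (ℚP.*-zeroʳ (- c))
    ... | true = begin
      signℚ (n ∸ rk π)
        ≡⟨ sym (trans (cong (signℚ (n ∸ rk π) *_) (signℚ-square (rk π ∸ rk τ))) (ℚP.*-identityʳ _)) ⟩
      signℚ (n ∸ rk π) * (t π * t π)
        ≡⟨ solve 2 (λ s u → s :* (u :* u) := (:- ((:- s) :* u)) :* u) refl (signℚ (n ∸ rk π)) (t π) ⟩
      (- (signℚ (suc (n ∸ rk π)) * t π)) * t π
        ≡⟨ cong (λ z → (- z) * t π) (sym (trans (cong signℚ (suc-n∸rkτ τ≤π)) (signℚ-+ (suc (n ∸ rk π)) (rk π ∸ rk τ)))) ⟩
      (- c) * t π ∎

module Λ'ν-Properties {n : ℕ} (Λ : GradedPoset n) (L : IsLattice Λ) (ν : Fin (GradedPoset.N Λ)) where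
  open GradedPosetProperties Λ
  open ChainSums Λ
  open IsLattice L
  open Construction Λ L ν

  ∈Λν-if-bounded : ∀ σ w → T (leH (join (el σ) (el ν)) (el w)) → inΛν σ ≡ true
  ∈Λν-if-bounded σ w bounded with join (el σ) (el ν)
  ... | el _ = refl

  ∈Λν-join : ∀ σ → inΛν σ ≡ true → ∃ λ w → join (el σ) (el ν) ≡ el w
  ∈Λν-join σ e with join (el σ) (el ν)
  ... | el w = w , refl

  ν≤⇒∈Λν : ∀ σ → le ν σ ≡ true → inΛν σ ≡ true
  ν≤⇒∈Λν σ ν≤σ = ∈Λν-if-bounded σ σ (join-least (el σ) (el ν) (el σ) (refl≤ σ) (≡true⇒T ν≤σ))

  bot∈Λν : inΛν bot ≡ true
  bot∈Λν = ∈Λν-if-bounded bot ν (join-least (el bot) (el ν) (el ν) (bot≤ ν) (refl≤ ν))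

  Λν-downClosed : DownClosed inΛν
  Λν-downClosed {y} {z} y<z z∈Λν with ∈Λν-join z z∈Λν
  ... | w , z∨ν≡w = ∈Λν-if-bounded y w (subst (λ j → T (leH (join (el y) (el ν)) j)) z∨ν≡w
        (join-least (el y) (el ν) (join (el z) (el ν))
          (≡true⇒T (leH-trans {el y} {el z} {join (el z) (el ν)} (<ᵇ⇒≤ᵇ y<z) (T⇒≡true (join-ub₁ (el z) (el ν)))))
          (join-ub₂ (el z) (el ν))))

  upperBound⇔join≤ : ∀ σ π → (le ν π ∧ le σ π) ≡ leH (join (el σ) (el ν)) (el π)
  upperBound⇔join≤ σ π with leH (join (el σ) (el ν)) (el π) in join≤π
  ... | true = ∧-≡true⁺
        (leH-trans {el ν} {join (el σ) (el ν)} {el π} (T⇒≡true (join-ub₂ (el σ) (el ν))) join≤π)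
        (leH-trans {el σ} {join (el σ) (el ν)} {el π} (T⇒≡true (join-ub₁ (el σ) (el ν))) join≤π)
  ... | false with le ν π ∧ le σ π in bounds
  ...   | false = refl
  ...   | true with () ← trans (sym (T⇒≡true (join-least (el σ) (el ν) (el π)
                          (≡true⇒T (proj₂ (∧-≡true⁻ {le ν π} bounds)))
                          (≡true⇒T (proj₁ (∧-≡true⁻ {le ν π} bounds))))))
                        join≤π

  toTop viaStar endWeight : Fin N → Poly
  toTop σ = gap (rk σ) (suc n)
  viaStar σ = gap (rk σ) n *ᴾ bᴾ
  endWeight σ = toTop σ +ᴾ when (not (le ν σ)) (viaStar σ)

  private
    chainsFromΛ'ν : ℕ → Prime N → Poly
    chainsFromΛ'ν = chainsFrom elemsΛ'ν ltΛ'ν rkΛ'ν (suc n)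

    gap-n-suc-n : gap n (suc n) ≋ 1ᴾ
    gap-n-suc-n = ≡⇒≋ (cong (λ e → a-b ^ᴾ (e ∸ 1)) (m+n∸n≡m 1 n))

    chainsFrom-star : ∀ k → chainsFromΛ'ν k star ≋ 1ᴾ
    chainsFrom-star zero = ≋-trans (chainsFrom-zero elemsΛ'ν ltΛ'ν rkΛ'ν (suc n) star) gap-n-suc-n
    chainsFrom-star (suc k) = ≋-trans (chainsFrom-suc elemsΛ'ν ltΛ'ν rkΛ'ν (suc n) k star)
      (≋-trans (+ᴾ-congʳ (gap n (suc n)) (∑ᴾ-zero elemsΛ'ν _ (λ _ → ≋-refl)))
               (≋-trans (+ᴾ-identityʳ (gap n (suc n))) gap-n-suc-n))

    chainsFrom-old-suc : ∀ k x → chainsFromΛ'ν (suc k) (old x)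
      ≋ endWeight x +ᴾ ∑ᴾ (allFin N) (λ y → when (inΛν y ∧ lt x y) (link x y *ᴾ chainsFromΛ'ν k (old y)))
    chainsFrom-old-suc k x =
      ≋-trans (chainsFrom-suc elemsΛ'ν ltΛ'ν rkΛ'ν (suc n) k (old x))
        (≋-trans (+ᴾ-congʳ (toTop x) (successors _)) (≋-sym (+ᴾ-assoc (toTop x) _ _)))
      where
      term : Prime N → Poly
      term y = when (ltΛ'ν (old x) y) (gap (rk x) (rkΛ'ν y) *ᴾ bᴾ *ᴾ chainsFromΛ'ν k y)
      successors : (Q? : ∀ σ → Dec (T (inΛν σ))) → ∑ᴾ (star ∷ map old (filter Q? (allFin N))) term
        ≋ when (not (le ν x)) (viaStar x) +ᴾ ∑ᴾ (allFin N) (λ y → when (inΛν y ∧ lt x y) (link x y *ᴾ chainsFromΛ'ν k (old y)))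
      successors Q? = +ᴾ-cong
        (when-cong (not (le ν x)) (≋-trans (*ᴾ-congʳ (viaStar x) (chainsFrom-star k)) (*ᴾ-identityʳ (viaStar x))))
        (≋-trans (∑ᴾ-map old (filter Q? (allFin N)) term)
          (≋-trans (∑ᴾ-filter inΛν Q? (allFin N) (λ y → term (old y)))
                   (∑ᴾ-cong (allFin N) (λ y → ≡⇒≋ (when-∧ (inΛν y) (lt x y) _)))))

    chainsFrom-old : ∀ k x → above inΛν x ≤ k → chainsFromΛ'ν (suc k) (old x) ≋ chainSum inΛν endWeight k x
    chainsFrom-old zero x bound = ≋-trans (chainsFrom-old-suc zero x)
      (≋-trans (+ᴾ-congʳ (endWeight x) (∑ᴾ-when-false (allFin N) _ _ (above≡0 inΛν x (n≤0⇒n≡0 bound))))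
               (+ᴾ-identityʳ (endWeight x)))
    chainsFrom-old (suc k) x bound = ≋-trans (chainsFrom-old-suc (suc k) x)
      (+ᴾ-congʳ (endWeight x) (∑ᴾ-when-cong (allFin N) (λ y → inΛν y ∧ lt x y) (λ y e →
        *ᴾ-congʳ (link x y) (chainsFrom-old k y (above-step inΛν e bound)))))

  ΨΛ'ν≋chainSum : ΨΛ'ν ≋ chainSum inΛν endWeight (suc N) bot
  ΨΛ'ν≋chainSum = fuel _
    where
    fuel : (Q? : ∀ σ → Dec (T (inΛν σ))) →
      chainsFromΛ'ν (suc (length (map old (filter Q? (allFin N))))) (old bot) ≋ chainSum inΛν endWeight (suc N) bot
    fuel Q? = ≋-trans (chainsFrom-old _ bot enough)
                      (chainSum-stable inΛν endWeight _ (suc N) bot enough (m≤n⇒m≤1+n (above≤N inΛν bot)))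
      where
      enough : above inΛν bot ≤ length (map old (filter Q? (allFin N)))
      enough = subst (above inΛν bot ≤_)
        (sym (trans (length-map old (filter Q? (allFin N))) (length-filter≡countᵇ inΛν Q? (allFin N))))
        (above≤count inΛν bot)

  upperTerm diagonalTerm : Fin N → Fin N → Poly
  upperTerm π σ = when (le ν π) (signℚ (n ∸ rk π) ·ᴾ when (le σ π) (toTop σ +ᴾ viaStar σ))
  diagonalTerm π σ = when (does (π ≟ σ)) (when (le ν π) (viaStar σ))

  module _ (eulerian : IsEulerian Λ) where
    open EulerianProperties Λ eulerian

    signed-sum-over-upper-bounds : ∀ σ →
      Σℚ (allFin N) (λ π → [ le ν π ∧ le σ π ]ℚ (signℚ (n ∸ rk π))) ≡ [ inΛν σ ]ℚ 1ℚ
    signed-sum-over-upper-bounds σ =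
      trans (Σℚ-cong (allFin N) (λ π → cong (λ b → [ b ]ℚ (signℚ (n ∸ rk π))) (upperBound⇔join≤ σ π)))
            (over (join (el σ) (el ν)))
      where
      over : ∀ j → Σℚ (allFin N) (λ π → [ leH j (el π) ]ℚ (signℚ (n ∸ rk π))) ≡ [ not (isOne j) ]ℚ 1ℚ
      over one = Σℚ-zero (allFin N) _ (λ π → refl)
      over (el τ) = signed-upper-sum τ

    ∑ᴾ-upperTerm : ∀ σ → ∑ᴾ (allFin N) (λ π → upperTerm π σ) ≋ when (inΛν σ) (toTop σ +ᴾ viaStar σ)
    ∑ᴾ-upperTerm σ = ≈⇒≋ λ w → begin
      coeff (∑ᴾ (allFin N) (λ π → upperTerm π σ)) w
        ≡⟨ trans (coeff-∑ᴾ (allFin N) (λ π → upperTerm π σ) w) (Σℚ-cong (allFin N) (λ π → coeff-upperTerm π w)) ⟩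
      Σℚ (allFin N) (λ π → [ le ν π ∧ le σ π ]ℚ (signℚ (n ∸ rk π)) * coeff H w)
        ≡⟨ Σℚ-*ʳ (allFin N) (coeff H w) _ ⟩
      Σℚ (allFin N) (λ π → [ le ν π ∧ le σ π ]ℚ (signℚ (n ∸ rk π))) * coeff H w
        ≡⟨ cong (_* coeff H w) (signed-sum-over-upper-bounds σ) ⟩
      [ inΛν σ ]ℚ 1ℚ * coeff H w
        ≡⟨ sym (coeff-when (inΛν σ) H w) ⟩
      coeff (when (inΛν σ) H) w ∎
      where
      open ≡-Reasoning
      H = toTop σ +ᴾ viaStar σ
      coeff-upperTerm : ∀ π w → coeff (upperTerm π σ) w ≡ [ le ν π ∧ le σ π ]ℚ (signℚ (n ∸ rk π)) * coeff H w
      coeff-upperTerm π w with le ν π | le σ π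
      ... | false | _ = sym (ℚP.*-zeroˡ (coeff H w))
      ... | true | true = coeff-·ᴾ (signℚ (n ∸ rk π)) H w
      ... | true | false = sym (ℚP.*-zeroˡ (coeff H w))

    ∑ᴾ-diagonalTerm : ∀ σ → ∑ᴾ (allFin N) (λ π → diagonalTerm π σ) ≋ when (le ν σ) (viaStar σ)
    ∑ᴾ-diagonalTerm σ = ∑ᴾ-allFin-δ σ (λ π → when (le ν π) (viaStar σ))

    -- On Λ_ν the end weight is (toTop + viaStar) − [ν ≤ σ] viaStar, and the Eulerian sum turns the
    -- indicator of Λ_ν into a signed sum over the π ≥ ν.
    endWeight-decomposition : ∀ σ → when (inΛν σ) (endWeight σ)
      ≋ ∑ᴾ (allFin N) (λ π → upperTerm π σ) -ᴾ ∑ᴾ (allFin N) (λ π → diagonalTerm π σ)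
    endWeight-decomposition σ =
      ≋-trans (restricted (le ν σ) refl) (≋-sym (-ᴾ-cong (∑ᴾ-upperTerm σ) (∑ᴾ-diagonalTerm σ)))
      where
      restricted : ∀ b → b ≡ le ν σ →
        when (inΛν σ) (toTop σ +ᴾ when (not b) (viaStar σ)) ≋ when (inΛν σ) (toTop σ +ᴾ viaStar σ) -ᴾ when b (viaStar σ)
      restricted false _ = ≋-sym (+ᴾ-identityʳ _)
      restricted true ν≤σ rewrite ν≤⇒∈Λν σ (sym ν≤σ) =
        ≋-trans (+ᴾ-identityʳ (toTop σ)) (≋-sym (-ᴾ-cancelʳ (toTop σ) (viaStar σ)))

  exitWeight-at : ∀ π → toTop π +ᴾ viaStar π ≋ exitWeight (n ∸ rk π)
  exitWeight-at π = +ᴾ-congˡ (viaStar π) (≡⇒≋ (cong (λ e → a-b ^ᴾ (e ∸ 1)) (+-∸-assoc 1 (rk≤n π))))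

  exitWeight-through : ∀ {τ π} → lt τ π ≡ true →
    toTop τ +ᴾ viaStar τ ≋ gap (rk τ) (rk π) *ᴾ exitWeight (suc (n ∸ rk π))
  exitWeight-through {τ} {π} τ<π = begin
    a-b ^ᴾ ((suc n ∸ rk τ) ∸ 1) +ᴾ a-b ^ᴾ ((n ∸ rk τ) ∸ 1) *ᴾ bᴾ
      ≡⟨ cong₂ (λ i j → a-b ^ᴾ i +ᴾ a-b ^ᴾ j *ᴾ bᴾ) toTop-exponent viaStar-exponent ⟩
    a-b ^ᴾ (g +ℕ suc k) +ᴾ a-b ^ᴾ (g +ℕ k) *ᴾ bᴾ
      ≈⟨ +ᴾ-cong (^ᴾ-+ a-b g (suc k)) (≋-trans (*ᴾ-congˡ bᴾ (^ᴾ-+ a-b g k)) (*ᴾ-assoc (a-b ^ᴾ g) (a-b ^ᴾ k) bᴾ)) ⟩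
    a-b ^ᴾ g *ᴾ a-b ^ᴾ suc k +ᴾ a-b ^ᴾ g *ᴾ (a-b ^ᴾ k *ᴾ bᴾ)
      ≈⟨ *ᴾ-distribˡ (a-b ^ᴾ g) (a-b ^ᴾ suc k) (a-b ^ᴾ k *ᴾ bᴾ) ⟨
    a-b ^ᴾ g *ᴾ exitWeight (suc k) ∎
    where
    open ≋-Reasoning
    g = (rk π ∸ rk τ) ∸ 1
    k = n ∸ rk π
    n∸rkτ : n ∸ rk τ ≡ g +ℕ suc k
    n∸rkτ = ∸-through (rk-mono-< τ<π) (rk≤n π)
    toTop-exponent : (suc n ∸ rk τ) ∸ 1 ≡ g +ℕ suc k
    toTop-exponent = trans (cong (_∸ 1) (+-∸-assoc 1 (rk≤n τ))) n∸rkτ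
    viaStar-exponent : (n ∸ rk τ) ∸ 1 ≡ g +ℕ k
    viaStar-exponent = cong (_∸ 1) (trans n∸rkτ (+-suc g k))

  ψ : Fin N → ℕ → Fin N → Poly
  ψ π = chainSum (λ z → lt z π) (λ z → gap (rk z) (rk π))

  module _ (0<ν : lt bot ν ≡ true) where

    chainSum-upperTerm : ∀ π → le ν π ≡ true → chainSum everything (λ σ → when (le σ π) (toTop σ +ᴾ viaStar σ)) (suc N) bot
      ≋ ψ π N bot *ᴾ (exitWeight (suc (n ∸ rk π)) +ᴾ bᴾ *ᴾ exitWeight (n ∸ rk π))
    chainSum-upperTerm π ν≤π =
      ≋-trans (chainSum-through π f f≰π (exitWeight (suc (n ∸ rk π))) f<π N bot (<ᵇ-≤ᵇ-trans 0<ν ν≤π)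
                                (above≤N (λ z → lt z π) bot))
              (*ᴾ-congʳ (ψ π N bot) (+ᴾ-congʳ (exitWeight (suc (n ∸ rk π)))
                                              (*ᴾ-congʳ bᴾ (≋-trans f-at-π (exitWeight-at π)))))
      where
      f : Fin N → Poly
      f σ = when (le σ π) (toTop σ +ᴾ viaStar σ)
      f≰π : ∀ τ → le τ π ≡ false → f τ ≋ 0ᴾ
      f≰π τ τ≰π rewrite τ≰π = ≋-refl
      f<π : ∀ τ → lt τ π ≡ true → f τ ≋ gap (rk τ) (rk π) *ᴾ exitWeight (suc (n ∸ rk π))
      f<π τ τ<π rewrite <ᵇ⇒≤ᵇ τ<π = exitWeight-through τ<π
      f-at-π : f π ≋ toTop π +ᴾ viaStar π
      f-at-π rewrite ≤ᵇ-refl π = ≋-refl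

    chainSum-diagonalTerm : ∀ π → le ν π ≡ true →
      chainSum everything (λ σ → when (does (π ≟ σ)) (viaStar σ)) (suc N) bot
        ≋ ψ π N bot *ᴾ (bᴾ *ᴾ (a-b ^ᴾ ((n ∸ rk π) ∸ 1) *ᴾ bᴾ))
    chainSum-diagonalTerm π ν≤π =
      ≋-trans (chainSum-through π f f≰π 0ᴾ f<π N bot (<ᵇ-≤ᵇ-trans 0<ν ν≤π) (above≤N (λ z → lt z π) bot))
              (*ᴾ-congʳ (ψ π N bot) (*ᴾ-congʳ bᴾ f-at-π))
      where
      f : Fin N → Poly
      f σ = when (does (π ≟ σ)) (viaStar σ)
      f≰π : ∀ τ → le τ π ≡ false → f τ ≋ 0ᴾ
      f≰π τ τ≰π with π ≟ τ
      ... | no _ = ≋-refl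
      ... | yes refl with () ← trans (sym (≤ᵇ-refl π)) τ≰π
      f<π : ∀ τ → lt τ π ≡ true → f τ ≋ gap (rk τ) (rk π) *ᴾ 0ᴾ
      f<π τ τ<π with π ≟ τ
      ... | no _ = ≋-sym (*ᴾ-zeroʳ (gap (rk τ) (rk π)))
      ... | yes refl = ⊥-elim (<ᵇ⇒≢ τ<π refl)
      f-at-π : f π ≋ viaStar π
      f-at-π with π ≟ π
      ... | yes _ = ≋-refl
      ... | no π≢π = ⊥-elim (π≢π refl)

    chainSum-at-π : ∀ π →
      chainSum everything (upperTerm π) (suc N) bot -ᴾ chainSum everything (diagonalTerm π) (suc N) bot
        ≋ when (le ν π) (ψ π N bot *ᴾ α (suc n ∸ rk π))
    chainSum-at-π π = begin
      chainSum everything (upperTerm π) (suc N) bot -ᴾ chainSum everything (diagonalTerm π) (suc N) bot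
        ≈⟨ -ᴾ-cong (≋-trans (chainSum-when everything (le ν π) (λ σ → s ·ᴾ f₁ σ) (suc N) bot)
                            (when-cong (le ν π) (chainSum-· everything s f₁ (suc N) bot)))
                   (≋-trans (chainSum-cong everything (λ σ → ≡⇒≋ (when-comm (does (π ≟ σ)) (le ν π) _)) (suc N) bot)
                            (chainSum-when everything (le ν π) f₂ (suc N) bot)) ⟩
      when (le ν π) (s ·ᴾ chainSum everything f₁ (suc N) bot) -ᴾ when (le ν π) (chainSum everything f₂ (suc N) bot)
        ≡⟨ sym (when-diffᴾ (le ν π) _ _) ⟩
      when (le ν π) (s ·ᴾ chainSum everything f₁ (suc N) bot -ᴾ chainSum everything f₂ (suc N) bot)
        ≈⟨ when-cong-if (le ν π) (λ ν≤π → ≋-trans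
             (-ᴾ-cong (·ᴾ-cong s (chainSum-upperTerm π ν≤π)) (chainSum-diagonalTerm π ν≤π))
             (≋-trans (*ᴾ-distribˡ-combination s (ψ π N bot) _ _)
                      (*ᴾ-congʳ (ψ π N bot) (≋-trans (α-identity k) (≡⇒≋ (cong α (sym (+-∸-assoc 1 (rk≤n π))))))))) ⟩
      when (le ν π) (ψ π N bot *ᴾ α (suc n ∸ rk π)) ∎
      where
      open ≋-Reasoning
      k = n ∸ rk π
      s = signℚ k
      f₁ f₂ : Fin N → Poly
      f₁ σ = when (le σ π) (toTop σ +ᴾ viaStar σ)
      f₂ σ = when (does (π ≟ σ)) (viaStar σ)

theorem3p5 : (n : ℕ) (Λ : GradedPoset n) (L : IsLattice Λ) → IsEulerian Λ →
    (ν : Fin' Λ) → T (GradedPoset.lt Λ (GradedPoset.bot Λ) ν) →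
    Construction.ΨΛ'ν Λ L ν ≈ᴾ Construction.RHS Λ L ν
theorem3p5 n Λ L eulerian ν 0<ν = ≋⇒≈ (begin
  ΨΛ'ν
    ≈⟨ ΨΛ'ν≋chainSum ⟩
  chainSum inΛν endWeight (suc N) bot
    ≈⟨ chainSum-restrict inΛν Λν-downClosed endWeight (suc N) bot bot∈Λν ⟩
  chainSum everything (λ σ → when (inΛν σ) (endWeight σ)) (suc N) bot
    ≈⟨ chainSum-cong everything (endWeight-decomposition eulerian) (suc N) bot ⟩
  chainSum everything (λ σ → ∑ᴾ (allFin N) (λ π → upperTerm π σ) -ᴾ ∑ᴾ (allFin N) (λ π → diagonalTerm π σ)) (suc N) bot
    ≈⟨ chainSum-∑ᴾ-diff everything (allFin N) upperTerm diagonalTerm (suc N) bot ⟩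
  ∑ᴾ (allFin N) (λ π → chainSum everything (upperTerm π) (suc N) bot -ᴾ chainSum everything (diagonalTerm π) (suc N) bot)
    ≈⟨ ∑ᴾ-cong (allFin N) (chainSum-at-π (T⇒≡true 0<ν)) ⟩
  ∑ᴾ (allFin N) (λ π → when (le ν π) (ψ π N bot *ᴾ α (suc n ∸ rk π)))
    ≈⟨ ∑ᴾ-cong (allFin N) (λ π → when-cong (le ν π) (*ᴾ-congˡ (α (suc n ∸ rk π)) (Ψ-below≋chainSum Λ π _))) ⟨
  ∑ᴾ (allFin N) (λ π → when (le ν π) (Ψbelow π *ᴾ α (suc n ∸ rk π)))
    ≈⟨ ∑ᴾ-filter (le ν) _ (allFin N) _ ⟨
  RHS ∎)
  where
  open Λ'ν-Properties Λ L ν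
  open GradedPosetProperties Λ
  open ChainSums Λ
  open Construction Λ L ν
  open ≋-Reasoning
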